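{- Let $C_n=\frac{1}{n+1}\binom{2n}{n}$. Consider lattice paths with steps $(1,1)$ (up) and $(1,-1)$ (down) from $(0,0)$ to $(2n+1,1)$, over all $n\ge 0$. (1) Let $x f(x,y)$ be the generating function of such paths that start with an up step, where each up step starting on or below the $x$-axis has weight $x$, each up step starting above the $x$-axis has weight $y$, and down steps have weight $1$. Then $f(x,y)=\sum_{n\ge0}C_n\sum_{i=0}^{n}x^iy^{n-i}$. (2) Let $x g(x,y)$ be the generating function of such paths that start with a down step, where each down step starting on or below the $x$-axis has weight $x$, each down step starting above the $x$-axis has weight $y$, and up steps have weight $1$. Then $g(x,y)=\sum_{n\ge0}C_{n+1}\sum_{i=0}^{n}x^iy^{n-i}$. (3) Let $y h(x,y)$ be the generating function of all such paths, where every vertex other than the initial vertex receives weight $x$ if it lies on or below the $x$-axis and weight $y$ if it lies above the $x$-axis. Then $h(x,y)=\sum_{n\ge0}C_n\sum_{i=0}^{2n}x^iy^{2n-i}$.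
   Context: The weight of a path is the product of the weights of its steps (respectively vertices), and the generating function is the sum of the weights of all paths in the class. A step starts on or below the $x$-axis if its initial vertex has $y$-coordinate $\le 0$. -}

module Defs where

open import Data.Nat using (ℕ; zero; suc; _+_; _*_; _∸_; _/_)
open import Data.Nat.Combinatorics using (_C_)
open import Data.Integer as ℤ using (ℤ; +_; _≤?_) renaming (_+_ to _+ℤ_; _-_ to _-ℤ_)
open import Data.Bool using (Bool; true; false; if_then_else_; _∧_)
open import Data.List using (List; []; _∷_; map; _++_)
open import Data.Nat.ListAction using (sum)
open import Data.Vec using (Vec; []; _∷_)
open import Data.Product using (_×_; _,_)
open import Relation.Nullary.Decidable using (⌊_⌋)
import Data.Nat as ℕ

Catalan : ℕ → ℕ
Catalan n = ((2 * n) C n) / suc n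

-- Steps: U = (1,1), D = (1,-1).  A path of length m is a vector of m steps,
-- always starting at (0,0).
data Step : Set where
  U D : Step

Path : ℕ → Set
Path m = Vec Step m

allPaths : (m : ℕ) → List (Path m)
allPaths zero = [] ∷ []
allPaths (suc m) = map (U ∷_) (allPaths m) ++ map (D ∷_) (allPaths m)

move : Step → ℤ → ℤ
move U h = h +ℤ + 1
move D h = h -ℤ + 1

endFrom : ∀ {m} → ℤ → Path m → ℤ
endFrom h [] = h
endFrom h (s ∷ p) = endFrom (move s h) p

endsAtOne : ∀ {m} → Path m → Bool
endsAtOne p = ⌊ endFrom (+ 0) p ℤ.≟ + 1 ⌋

startsWith : Step → ∀ {m} → Path m → Bool
startsWith _ [] = false
startsWith U (U ∷ _) = true
startsWith D (D ∷ _) = true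
startsWith _ _ = false

onOrBelow : ℤ → Bool
onOrBelow h = ⌊ h ≤? + 0 ⌋

-- a monomial x^a y^b is represented by its exponent pair (a , b)
Mono : Set
Mono = ℕ × ℕ

mulX mulY : Mono → Mono
mulX (a , b) = (suc a , b)
mulY (a , b) = (a , suc b)

stepWeight : Step → ∀ {m} → ℤ → Path m → Mono
stepWeight s h [] = (0 , 0)
stepWeight U h (U ∷ p) =
  (if onOrBelow h then mulX else mulY) (stepWeight U (move U h) p)
stepWeight U h (D ∷ p) = stepWeight U (move D h) p
stepWeight D h (D ∷ p) =
  (if onOrBelow h then mulX else mulY) (stepWeight D (move D h) p)
stepWeight D h (U ∷ p) = stepWeight D (move U h) p

-- weight (3): every vertex except the initial one has weight x if its height
-- is ≤ 0 and y otherwise (h = height of the current vertex, which is not weighted)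
vertexWeight : ∀ {m} → ℤ → Path m → Mono
vertexWeight h [] = (0 , 0)
vertexWeight h (s ∷ p) =
  (if onOrBelow (move s h) then mulX else mulY) (vertexWeight (move s h) p)

-- Formal power series in x, y with ℕ coefficients, given by coefficient function:
-- F a b = coefficient of x^a y^b.
Series : Set
Series = ℕ → ℕ → ℕ

δ : ℕ → ℕ → ℕ
δ a b = if ⌊ a ℕ.≟ b ⌋ then 1 else 0

monoEq : Mono → Mono → Bool
monoEq (a , b) (c , d) = ⌊ a ℕ.≟ c ⌋ ∧ ⌊ b ℕ.≟ d ⌋

sumTo : ℕ → (ℕ → ℕ) → ℕ
sumTo zero f = f 0
sumTo (suc n) f = sumTo n f + f (suc n)

count : ∀ {m} → (Path m → Bool) → List (Path m) → ℕ
count P ps = sum (map (λ p → if P p then 1 else 0) ps)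

-- In every case below a path of length 2n+1 has
-- weight of total degree ≥ n, so only n ≤ a + b can contribute: the finite sum
-- over n ≤ a + b is exactly the coefficient of the full (infinite) sum over n.
gf : (cls : ∀ {m} → Path m → Bool) (w : ∀ {m} → Path m → Mono) → Series
gf cls w a b = sumTo (a + b) λ n →
  count (λ p → endsAtOne p ∧ cls p ∧ monoEq (w p) (a , b)) (allPaths (suc (2 * n)))

noClass : ∀ {m} → Path m → Bool
noClass _ = true

-- the series  Σ_{n ≥ 0} c n Σ_{i=0}^{k n} x^i y^{k n - i}   (k ≥ 1, so only n ≤ a+b
-- contribute to the coefficient of x^a y^b)
homSum : ℕ → (ℕ → ℕ) → Series
homSum k c a b = sumTo (a + b) λ n → sumTo (k * n) λ i → c n * δ i a * δ (k * n ∸ i) b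

xTimes yTimes : Series → Series
xTimes F zero b = 0
xTimes F (suc a) b = F a b
yTimes F a zero = 0
yTimes F a (suc b) = F a b

xf xg yh : Series
xf = gf (startsWith U) (stepWeight U (+ 0))
xg = gf (startsWith D) (stepWeight D (+ 0))
yh = gf noClass (vertexWeight (+ 0))

-- Each generating function is a sum over n of coefficients of a transfer series: the number of paths of given
-- length from a height h to height 1 with given weight, which obeys a one-step recursion in the length.  The heart
-- of the proof is a Chung–Feller uniformity: on the relevant antidiagonal a + b = const all coefficients x^a y^b
-- coincide.  It follows, by induction on the length simultaneously for all starting heights, from trade identities:
-- moving one unit of weight between x and y changes a coefficient only by a first-passage count times a loop count,
-- and at the starting height of interest this correction vanishes or cancels, by reflection of first passages.
-- The common value is the Catalan number because the n + 1 equal coefficients of the up-step series add up to the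
-- number of all paths, the central binomial coefficient.

module Submission where

open import Defs
open import Data.Bool using (Bool; true; false; if_then_else_; _∧_)
open import Data.Bool.Properties using (∧-zeroʳ)
open import Data.Empty using (⊥; ⊥-elim)
open import Data.Integer as ℤ using (ℤ; +_; -[1+_]; -_)
open import Data.List using (List; []; _∷_; map; _++_)
open import Data.Nat as ℕ using (ℕ; zero; suc; _+_; _*_; _∸_; _≤_; z≤n; s≤s; _/_)
open import Data.Nat.Combinatorics using (_C_; nCk+nC[k+1]≡[n+1]C[k+1])
open import Data.Nat.DivMod using (m*n/n≡m)
open import Data.Nat.Properties
open import Data.Nat.Tactic.RingSolver using (solve-∀)
open import Data.Product using (_×_; _,_; proj₁; proj₂)
open import Data.Sum using (_⊎_; inj₁; inj₂)
open import Data.Vec using ([]; _∷_)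
open import Function using (_∘′_)
open import Relation.Binary.PropositionalEquality
open import Relation.Nullary using (yes; no; ¬_)
open import Relation.Nullary.Decidable using (⌊_⌋; decidable-stable)

-- Paths counted by a transfer recursion

-- Structural successor and predecessor on ℤ: unlike move, they compute on constructor patterns.
sucℤ predℤ : ℤ → ℤ
sucℤ (+ n) = + suc n
sucℤ -[1+ zero ] = + 0
sucℤ -[1+ suc n ] = -[1+ n ]
predℤ (+ zero) = -[1+ 0 ]
predℤ (+ suc n) = + n
predℤ -[1+ n ] = -[1+ suc n ]

step : Step → ℤ → ℤ
step U = sucℤ
step D = predℤ

move≡step : ∀ s h → move s h ≡ step s h
move≡step U (+ n) = cong +_ (+-comm n 1)
move≡step U -[1+ zero ] = refl
move≡step U -[1+ suc n ] = refl
move≡step D (+ zero) = refl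
move≡step D (+ suc n) = refl
move≡step D -[1+ n ] = cong (λ k → -[1+ suc k ]) (+-identityʳ n)

count-++ : ∀ {m} (P : Path m → Bool) xs ys → count P (xs ++ ys) ≡ count P xs + count P ys
count-++ P [] ys = refl
count-++ P (x ∷ xs) ys = trans (cong (_+_ (if P x then 1 else 0)) (count-++ P xs ys)) (sym (+-assoc (if P x then 1 else 0) _ _))

count-map : ∀ {m k} (P : Path m → Bool) (f : Path k → Path m) xs → count P (map f xs) ≡ count (λ p → P (f p)) xs
count-map P f [] = refl
count-map P f (x ∷ xs) = cong (_+_ (if P (f x) then 1 else 0)) (count-map P f xs)

count-cong : ∀ {m} {P Q : Path m → Bool} → (∀ p → P p ≡ Q p) → ∀ xs → count P xs ≡ count Q xs
count-cong e [] = refl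
count-cong e (x ∷ xs) = cong₂ (λ c n → (if c then 1 else 0) + n) (e x) (count-cong e xs)

count-false : ∀ {m} {P : Path m → Bool} → (∀ p → P p ≡ false) → ∀ xs → count P xs ≡ 0
count-false e [] = refl
count-false e (x ∷ xs) rewrite e x = count-false e xs

count-allPaths-suc : ∀ {m} (P : Path (suc m) → Bool) →
  count P (allPaths (suc m)) ≡ count (λ p → P (U ∷ p)) (allPaths m) + count (λ p → P (D ∷ p)) (allPaths m)
count-allPaths-suc {m} P = trans (count-++ P (map (U ∷_) (allPaths m)) (map (D ∷_) (allPaths m)))
  (cong₂ _+_ (count-map P (U ∷_) (allPaths m)) (count-map P (D ∷_) (allPaths m)))

data Factor : Set where
  𝟙 𝕩 𝕪 : Factor

_·ᵐ_ : Factor → Mono → Mono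
𝟙 ·ᵐ w = w
𝕩 ·ᵐ w = mulX w
𝕪 ·ᵐ w = mulY w

_·ˢ_ : Factor → Series → Series
(𝟙 ·ˢ F) a b = F a b
(𝕩 ·ˢ F) a b = xTimes F a b
(𝕪 ·ˢ F) a b = yTimes F a b

xOrY : Bool → Factor
xOrY true = 𝕩
xOrY false = 𝕪

if-mulX-mulY : ∀ c w → (if c then mulX else mulY) w ≡ xOrY c ·ᵐ w
if-mulX-mulY true w = refl
if-mulX-mulY false w = refl

series : ∀ {m} → (Path m → Bool) → (Path m → Mono) → List (Path m) → Series
series E W ps a b = count (λ p → E p ∧ monoEq (W p) (a , b)) ps

≟-suc : ∀ x y → ⌊ suc x ℕ.≟ suc y ⌋ ≡ ⌊ x ℕ.≟ y ⌋
≟-suc x y with x ℕ.≟ y | suc x ℕ.≟ suc y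
... | yes _ | yes _ = refl
... | no _ | no _ = refl
... | yes x≡y | no sx≢sy = ⊥-elim (sx≢sy (cong suc x≡y))
... | no x≢y | yes sx≡sy = ⊥-elim (x≢y (suc-injective sx≡sy))

series-· : ∀ {m} f (E : Path m → Bool) (W : Path m → Mono) ps a b →
  series E (λ p → f ·ᵐ W p) ps a b ≡ (f ·ˢ series E W ps) a b
series-· 𝟙 E W ps a b = refl
series-· 𝕩 E W ps zero b = count-false (λ p → ∧-zeroʳ (E p)) ps
series-· 𝕩 E W ps (suc a) b =
  count-cong (λ p → cong (λ t → E p ∧ (t ∧ ⌊ proj₂ (W p) ℕ.≟ b ⌋)) (≟-suc (proj₁ (W p)) a)) ps
series-· 𝕪 E W ps a zero =
  count-false (λ p → trans (cong (E p ∧_) (∧-zeroʳ ⌊ proj₁ (W p) ℕ.≟ a ⌋)) (∧-zeroʳ (E p))) ps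
series-· 𝕪 E W ps a (suc b) =
  count-cong (λ p → cong (λ t → E p ∧ (⌊ proj₁ (W p) ℕ.≟ a ⌋ ∧ t)) (≟-suc (proj₂ (W p)) b)) ps

·ˢ-cong : ∀ f {F G : Series} → (∀ a b → F a b ≡ G a b) → ∀ a b → (f ·ˢ F) a b ≡ (f ·ˢ G) a b
·ˢ-cong 𝟙 F≡G a b = F≡G a b
·ˢ-cong 𝕩 F≡G zero b = refl
·ˢ-cong 𝕩 F≡G (suc a) b = F≡G a b
·ˢ-cong 𝕪 F≡G a zero = refl
·ˢ-cong 𝕪 F≡G a (suc b) = F≡G a b

xOrY-support : ∀ c (F : Series) {n} → (∀ a b → F a b ≢ 0 → a + b ≡ n) → ∀ a b → (xOrY c ·ˢ F) a b ≢ 0 → a + b ≡ suc n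
xOrY-support true F supp zero b F≢0 = ⊥-elim (F≢0 refl)
xOrY-support true F supp (suc a) b F≢0 = cong suc (supp a b F≢0)
xOrY-support false F supp a zero F≢0 = ⊥-elim (F≢0 refl)
xOrY-support false F supp a (suc b) F≢0 = trans (+-suc a b) (cong suc (supp a b F≢0))

Rule : Set
Rule = Step → ℤ → Factor

-- transfer φ m h a b counts the paths of length m from height h to height 1 whose φ-weight is x^a y^b.
transfer : Rule → ℕ → ℤ → Series
transfer φ zero h a b = if ⌊ h ℤ.≟ + 1 ⌋ ∧ monoEq (0 , 0) (a , b) then 1 else 0
transfer φ (suc m) h a b = (φ U h ·ˢ transfer φ m (sucℤ h)) a b + (φ D h ·ˢ transfer φ m (predℤ h)) a b

record Obeys (φ : Rule) (w : ∀ {m} → ℤ → Path m → Mono) : Set where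
  field
    nil : ∀ h → w h [] ≡ (0 , 0)
    cons : ∀ {m} s h (p : Path m) → w h (s ∷ p) ≡ φ s h ·ᵐ w (move s h) p

endsAtOneFrom : ℤ → ∀ {m} → Path m → Bool
endsAtOneFrom h p = ⌊ endFrom h p ℤ.≟ + 1 ⌋

module _ {φ : Rule} {w : ∀ {m} → ℤ → Path m → Mono} (obeys : Obeys φ w) where
  open Obeys obeys

  series-allPaths : ∀ m h a b → series (endsAtOneFrom h) (w h) (allPaths m) a b ≡ transfer φ m h a b
  series-cons : ∀ s m h a b → series (endsAtOneFrom (move s h)) (λ p → w h (s ∷ p)) (allPaths m) a b
                            ≡ (φ s h ·ˢ transfer φ m (step s h)) a b

  series-allPaths zero h a b =
    trans (+-identityʳ _) (cong (λ v → if endsAtOneFrom h [] ∧ monoEq v (a , b) then 1 else 0) (nil h))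
  series-allPaths (suc m) h a b =
    trans (count-allPaths-suc {m} _) (cong₂ _+_ (series-cons U m h a b) (series-cons D m h a b))

  series-cons s m h a b = begin
    series (endsAtOneFrom (move s h)) (λ p → w h (s ∷ p)) (allPaths m) a b
      ≡⟨ count-cong (λ p → cong (λ v → endsAtOneFrom (move s h) p ∧ monoEq v (a , b)) (cons s h p)) (allPaths m) ⟩
    series (endsAtOneFrom (move s h)) (λ p → φ s h ·ᵐ w (move s h) p) (allPaths m) a b
      ≡⟨ series-· (φ s h) (endsAtOneFrom (move s h)) (w (move s h)) (allPaths m) a b ⟩
    (φ s h ·ˢ series (endsAtOneFrom (move s h)) (w (move s h)) (allPaths m)) a b
      ≡⟨ ·ˢ-cong (φ s h) (series-allPaths m (move s h)) a b ⟩
    (φ s h ·ˢ transfer φ m (move s h)) a b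
      ≡⟨ cong (λ g → (φ s h ·ˢ transfer φ m g) a b) (move≡step s h) ⟩
    (φ s h ·ˢ transfer φ m (step s h)) a b ∎
    where open ≡-Reasoning

  series-startsWith : ∀ s m a b →
    count (λ p → endsAtOne p ∧ startsWith s p ∧ monoEq (w (+ 0) p) (a , b)) (allPaths (suc m))
      ≡ (φ s (+ 0) ·ˢ transfer φ m (step s (+ 0))) a b
  series-startsWith U m a b = trans (count-allPaths-suc {m} _)
    (trans (cong (_+_ _) (count-false (λ p → ∧-zeroʳ _) (allPaths m))) (trans (+-identityʳ _) (series-cons U m (+ 0) a b)))
  series-startsWith D m a b = trans (count-allPaths-suc {m} _)
    (cong₂ _+_ (count-false (λ p → ∧-zeroʳ _) (allPaths m)) (series-cons D m (+ 0) a b))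

stepRule : Step → Rule
stepRule U U h = xOrY (onOrBelow h)
stepRule U D h = 𝟙
stepRule D U h = 𝟙
stepRule D D h = xOrY (onOrBelow h)

vertexRule : Rule
vertexRule s h = xOrY (onOrBelow (step s h))

stepWeight-obeys : ∀ s → Obeys (stepRule s) (stepWeight s)
stepWeight-obeys s = record { nil = λ h → refl ; cons = cons s }
  where
  cons : ∀ s {m} t h (p : Path m) → stepWeight s h (t ∷ p) ≡ stepRule s t h ·ᵐ stepWeight s (move t h) p
  cons U U h p = if-mulX-mulY (onOrBelow h) _
  cons U D h p = refl
  cons D U h p = refl
  cons D D h p = if-mulX-mulY (onOrBelow h) _

vertexWeight-obeys : Obeys vertexRule vertexWeight
vertexWeight-obeys = record { nil = λ h → refl ; cons = cons }
  where
  cons : ∀ {m} s h (p : Path m) → vertexWeight h (s ∷ p) ≡ vertexRule s h ·ᵐ vertexWeight (move s h) p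
  cons s h p = trans (if-mulX-mulY (onOrBelow (move s h)) _)
                     (cong (λ g → xOrY (onOrBelow g) ·ᵐ vertexWeight (move s h) p) (move≡step s h))

+-interchange : ∀ x y z w → (x + y) + (z + w) ≡ (x + z) + (y + w)
+-interchange = solve-∀

≢0-stable : ∀ {n} → ¬ n ≢ 0 → n ≡ 0
≢0-stable {n} = decidable-stable (n ℕ.≟ 0)

+≢0⇒⊎≢0 : ∀ x y → x + y ≢ 0 → x ≢ 0 ⊎ y ≢ 0
+≢0⇒⊎≢0 zero y y≢0 = inj₂ y≢0
+≢0⇒⊎≢0 (suc x) y _ = inj₁ (λ ())

suc≡+suc⇒≡ : ∀ {m} k j → suc m ≡ k + suc j → m ≡ k + j
suc≡+suc⇒≡ k j eq = suc-injective (trans eq (+-suc k j))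

+-*-regroup : ∀ x y p q n → (x + p * n) + (y + q * n) ≡ (x + y) + (p + q) * n
+-*-regroup = solve-∀

+-*-regroup′ : ∀ x y p q n → (x + p * n) + (y + q * n) ≡ (x + y) + (q + p) * n
+-*-regroup′ = solve-∀

sumTo-cong : ∀ N {f g : ℕ → ℕ} → (∀ i → i ≤ N → f i ≡ g i) → sumTo N f ≡ sumTo N g
sumTo-cong zero f≡g = f≡g 0 z≤n
sumTo-cong (suc N) f≡g = cong₂ _+_ (sumTo-cong N (λ i i≤N → f≡g i (m≤n⇒m≤1+n i≤N))) (f≡g (suc N) ≤-refl)

sumTo-+ : ∀ N (f g : ℕ → ℕ) → sumTo N (λ i → f i + g i) ≡ sumTo N f + sumTo N g
sumTo-+ zero f g = refl
sumTo-+ (suc N) f g = trans (cong (_+ (f (suc N) + g (suc N))) (sumTo-+ N f g))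
  (+-interchange (sumTo N f) (sumTo N g) (f (suc N)) (g (suc N)))

sumTo-suc : ∀ N (f : ℕ → ℕ) → sumTo (suc N) f ≡ f 0 + sumTo N (λ i → f (suc i))
sumTo-suc zero f = refl
sumTo-suc (suc N) f = trans (cong (_+ f (suc (suc N))) (sumTo-suc N f)) (+-assoc (f 0) _ _)

sumTo-const : ∀ N c → sumTo N (λ _ → c) ≡ suc N * c
sumTo-const zero c = sym (+-identityʳ c)
sumTo-const (suc N) c = trans (cong (_+ c) (sumTo-const N c)) (+-comm (suc N * c) c)

sumTo-zero : ∀ N {f : ℕ → ℕ} → (∀ i → i ≤ N → f i ≡ 0) → sumTo N f ≡ 0
sumTo-zero N f≡0 = trans (sumTo-cong N f≡0) (trans (sumTo-const N 0) (*-zeroʳ (suc N)))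

sumTo-single : ∀ N (f : ℕ → ℕ) {c} → c ≤ N → (∀ i → i ≢ c → f i ≡ 0) → sumTo N f ≡ f c
sumTo-single zero f z≤n f≡0 = refl
sumTo-single (suc N) f {c} c≤1+N f≡0 with c ℕ.≟ suc N
... | yes refl = cong (_+ f (suc N)) (sumTo-zero N (λ i i≤N → f≡0 i (λ i≡c → <-irrefl i≡c (s≤s i≤N))))
... | no c≢1+N = trans (cong₂ _+_ (sumTo-single N f (≤-pred (≤∧≢⇒< c≤1+N c≢1+N)) f≡0) (f≡0 (suc N) (c≢1+N ∘′ sym)))
                       (+-identityʳ _)

δ-refl : ∀ x → δ x x ≡ 1
δ-refl x with x ℕ.≟ x
... | yes _ = refl
... | no x≢x = ⊥-elim (x≢x refl)

δ-≢ : ∀ {x y} → x ≢ y → δ x y ≡ 0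
δ-≢ {x} {y} x≢y with x ℕ.≟ y
... | yes x≡y = ⊥-elim (x≢y x≡y)
... | no _ = refl

*δ-≢ : ∀ c {x y} → x ≢ y → c * δ x y ≡ 0
*δ-≢ c x≢y = trans (cong (c *_) (δ-≢ x≢y)) (*-zeroʳ c)

homSum-inner-on : ∀ c a b → sumTo (a + b) (λ i → c * δ i a * δ (a + b ∸ i) b) ≡ c
homSum-inner-on c a b = begin
  sumTo (a + b) (λ i → c * δ i a * δ (a + b ∸ i) b)
    ≡⟨ sumTo-single (a + b) _ (m≤m+n a b) (λ i i≢a → cong (_* δ (a + b ∸ i) b) (*δ-≢ c i≢a)) ⟩
  c * δ a a * δ (a + b ∸ a) b
    ≡⟨ cong₂ (λ s t → c * s * t) (δ-refl a) (trans (cong (λ t → δ t b) (m+n∸m≡n a b)) (δ-refl b)) ⟩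
  c * 1 * 1
    ≡⟨ trans (*-identityʳ (c * 1)) (*-identityʳ c) ⟩
  c ∎
  where open ≡-Reasoning

homSum-inner : ∀ K c a b → sumTo K (λ i → c * δ i a * δ (K ∸ i) b) ≡ c * δ K (a + b)
homSum-inner K c a b with K ℕ.≟ a + b
... | yes refl = trans (homSum-inner-on c a b) (sym (*-identityʳ c))
... | no K≢a+b = trans (sumTo-zero K term≡0) (sym (*-zeroʳ c))
  where
  term≡0 : ∀ i → i ≤ K → c * δ i a * δ (K ∸ i) b ≡ 0
  term≡0 i i≤K with i ℕ.≟ a
  ... | no _ = cong (_* δ (K ∸ i) b) (*-zeroʳ c)
  ... | yes refl = *δ-≢ (c * 1) (λ K∸i≡b → K≢a+b (trans (sym (m+[n∸m]≡n i≤K)) (cong (_+_ i) K∸i≡b)))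

homSum-diagonal : ∀ k c a b → homSum k c a b ≡ sumTo (a + b) (λ n → c n * δ (k * n) (a + b))
homSum-diagonal k c a b = sumTo-cong (a + b) (λ n _ → homSum-inner (k * n) (c n) a b)

tTimes : (ℕ → ℕ) → ℕ → ℕ
tTimes f zero = 0
tTimes f (suc u) = f u

degreeSum : ℕ → Series → ℕ
degreeSum d F = sumTo d (λ i → F i (d ∸ i))

degreeSum-+ : ∀ d (F G : Series) → degreeSum d (λ a b → F a b + G a b) ≡ degreeSum d F + degreeSum d G
degreeSum-+ d F G = sumTo-+ d (λ i → F i (d ∸ i)) (λ i → G i (d ∸ i))

degreeSum-xOrY : ∀ c F d → degreeSum d (xOrY c ·ˢ F) ≡ tTimes (λ d → degreeSum d F) d
degreeSum-xOrY true F zero = refl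
degreeSum-xOrY true F (suc d) = sumTo-suc d (λ i → xTimes F i (suc d ∸ i))
degreeSum-xOrY false F zero = refl
degreeSum-xOrY false F (suc d) =
  trans (cong (_+_ (sumTo d (λ i → yTimes F i (suc d ∸ i)))) (cong (yTimes F (suc d)) (n∸n≡0 d)))
  (trans (+-identityʳ _) (sumTo-cong d (λ i i≤d → cong (yTimes F i) (+-∸-assoc 1 i≤d))))

-- First passages

-- firstPass j h u counts the paths of length j from h, with u up steps, that first reach height 1 at their end.
firstPass : ℕ → ℤ → ℕ → ℕ
firstPass zero h u = if ⌊ h ℤ.≟ + 1 ⌋ ∧ ⌊ u ℕ.≟ 0 ⌋ then 1 else 0
firstPass (suc j) h u = if ⌊ h ℤ.≟ + 1 ⌋ then 0 else firstPass j (predℤ h) u + tTimes (firstPass j (sucℤ h)) u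

sucℤ-neg : ∀ e → sucℤ (- + suc e) ≡ - + e
sucℤ-neg zero = refl
sucℤ-neg (suc e) = refl

firstPass-suc-≤0 : ∀ j e u → firstPass (suc j) (- + e) u ≡ firstPass j (- + suc e) u + tTimes (firstPass j (sucℤ (- + e))) u
firstPass-suc-≤0 j zero u = refl
firstPass-suc-≤0 j (suc zero) u = refl
firstPass-suc-≤0 j (suc (suc e)) u = refl

firstPass-suc-<0 : ∀ j e u → firstPass (suc j) (- + suc e) u ≡ firstPass j (- + suc (suc e)) u + tTimes (firstPass j (- + e)) u
firstPass-suc-<0 j e u =
  trans (firstPass-suc-≤0 j (suc e) u) (cong (λ h → firstPass j (- + suc (suc e)) u + tTimes (firstPass j h) u) (sucℤ-neg e))

firstPass-zero-below : ∀ e u → firstPass 0 (- + e) u ≡ 0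
firstPass-zero-below zero u = refl
firstPass-zero-below (suc e) u = refl

firstPass-at-1 : ∀ j u → firstPass j (+ 1) (suc u) ≡ 0
firstPass-at-1 zero u = refl
firstPass-at-1 (suc j) u = refl

firstPass-above-support : ∀ j e u → firstPass j (+ suc e) u ≢ 0 → j ≡ 2 * u + e
firstPass-above-support zero zero zero _ = refl
firstPass-above-support zero zero (suc u) fp≢0 = ⊥-elim (fp≢0 refl)
firstPass-above-support zero (suc e) u fp≢0 = ⊥-elim (fp≢0 refl)
firstPass-above-support (suc j) zero u fp≢0 = ⊥-elim (fp≢0 refl)
firstPass-above-support (suc j) (suc e) u fp≢0
  with +≢0⇒⊎≢0 (firstPass j (+ suc e) u) (tTimes (firstPass j (+ suc (suc (suc e)))) u) fp≢0
... | inj₁ down≢0 = trans (cong suc (firstPass-above-support j e u down≢0)) (sym (+-suc (2 * u) e))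
firstPass-above-support (suc j) (suc e) zero fp≢0 | inj₂ up≢0 = ⊥-elim (up≢0 refl)
firstPass-above-support (suc j) (suc e) (suc u) fp≢0 | inj₂ up≢0 =
  trans (cong suc (firstPass-above-support j (suc (suc e)) u up≢0)) (arith u e)
  where
  arith : ∀ u e → suc (2 * u + suc (suc e)) ≡ 2 * suc u + suc e
  arith = solve-∀

firstPass-below-support : ∀ j e u → firstPass j (- + e) u ≢ 0 → suc (j + e) ≡ 2 * u × suc e ≤ u
firstPass-below-support zero zero u fp≢0 = ⊥-elim (fp≢0 refl)
firstPass-below-support zero (suc e) u fp≢0 = ⊥-elim (fp≢0 refl)
firstPass-below-support (suc j) zero u fp≢0 with +≢0⇒⊎≢0 (firstPass j (- + 1) u) (tTimes (firstPass j (+ 1)) u) fp≢0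
... | inj₁ down≢0 with firstPass-below-support j 1 u down≢0
...   | len , 2≤u = trans (cong (λ k → suc (suc k)) (+-identityʳ j)) (trans (cong suc (+-comm 1 j)) len) , ≤-trans (n≤1+n 1) 2≤u
firstPass-below-support (suc j) zero zero fp≢0 | inj₂ up≢0 = ⊥-elim (up≢0 refl)
firstPass-below-support (suc j) zero (suc u) fp≢0 | inj₂ up≢0 =
  trans (cong (λ k → suc (suc (k + 0))) (firstPass-above-support j 0 u up≢0)) (arith u) , s≤s z≤n
  where
  arith : ∀ u → suc (suc (2 * u + 0 + 0)) ≡ 2 * suc u
  arith = solve-∀
firstPass-below-support (suc j) (suc e) u fp≢0
  with +≢0⇒⊎≢0 (firstPass j (- + suc (suc e)) u) (tTimes (firstPass j (- + e)) u) (subst (_≢ 0) (firstPass-suc-<0 j e u) fp≢0)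
... | inj₁ down≢0 with firstPass-below-support j (suc (suc e)) u down≢0
...   | len , bound = trans (cong suc (sym (+-suc j (suc e)))) len , ≤-trans (n≤1+n _) bound
firstPass-below-support (suc j) (suc e) zero fp≢0 | inj₂ up≢0 = ⊥-elim (up≢0 refl)
firstPass-below-support (suc j) (suc e) (suc u) fp≢0 | inj₂ up≢0 with firstPass-below-support j e u up≢0
... | len , bound = trans (cong (λ k → suc (suc k)) (+-suc j e)) (trans (cong (λ k → suc (suc k)) len) (arith u)) , s≤s bound
  where
  arith : ∀ u → suc (suc (2 * u)) ≡ 2 * suc u
  arith = solve-∀

firstPass-below≡0 : ∀ j e u → u ≤ e → firstPass j (- + e) u ≡ 0
firstPass-below≡0 j e u u≤e = ≢0-stable (λ fp≢0 → <⇒≱ (proj₂ (firstPass-below-support j e u fp≢0)) u≤e)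

-- Reflection in height 1: a first passage from 1 + (e + 1) down to 1 corresponds to one from 1 − (e + 1) up to 1.
firstPass-reflect : ∀ j e u → firstPass j (+ suc (suc e)) u ≡ firstPass j (- + e) (suc (e + u))
firstPass-reflect zero zero u = refl
firstPass-reflect zero (suc e) u = refl
firstPass-reflect (suc j) zero u =
  trans (cong (_+_ (firstPass j (+ 1) u)) (up u)) (+-comm (firstPass j (+ 1) u) (firstPass j (- + 1) (suc u)))
  where
  up : ∀ u → tTimes (firstPass j (+ 3)) u ≡ firstPass j (- + 1) (suc u)
  up zero = sym (firstPass-below≡0 j 1 1 ≤-refl)
  up (suc u) = firstPass-reflect j 1 u
firstPass-reflect (suc j) (suc e) u = begin
  firstPass j (+ suc (suc e)) u + tTimes (firstPass j (+ suc (suc (suc (suc e))))) u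
    ≡⟨ cong₂ _+_ (firstPass-reflect j e u) (up u) ⟩
  firstPass j (- + e) (suc (e + u)) + firstPass j (- + suc (suc e)) (suc (suc e + u))
    ≡⟨ +-comm (firstPass j (- + e) (suc (e + u))) _ ⟩
  firstPass j (- + suc (suc e)) (suc (suc e + u)) + firstPass j (- + e) (suc (e + u))
    ≡⟨ sym (firstPass-suc-<0 j e (suc (suc e + u))) ⟩
  firstPass (suc j) (- + suc e) (suc (suc e + u)) ∎
  where
  open ≡-Reasoning
  up : ∀ u → tTimes (firstPass j (+ suc (suc (suc (suc e))))) u ≡ firstPass j (- + suc (suc e)) (suc (suc e + u))
  up zero = sym (firstPass-below≡0 j (suc (suc e)) (suc (suc e + 0)) (≤-reflexive (cong (λ k → suc (suc k)) (+-identityʳ e))))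
  up (suc u) = trans (firstPass-reflect j (suc (suc e)) u)
                     (cong (λ k → firstPass j (- + suc (suc e)) (suc (suc k))) (sym (+-suc e u)))

-- Weighted up steps

Tᵘ : ℕ → ℤ → Series
Tᵘ = transfer (stepRule U)

Tᵘ-suc-≤0 : ∀ m e a b → Tᵘ (suc m) (- + e) a b ≡ xTimes (Tᵘ m (sucℤ (- + e))) a b + Tᵘ m (- + suc e) a b
Tᵘ-suc-≤0 m zero a b = refl
Tᵘ-suc-≤0 m (suc zero) a b = refl
Tᵘ-suc-≤0 m (suc (suc e)) a b = refl

Tᵘ-suc-<0 : ∀ m e a b → Tᵘ (suc m) (- + suc e) a b ≡ xTimes (Tᵘ m (- + e)) a b + Tᵘ m (- + suc (suc e)) a b
Tᵘ-suc-<0 m e a b =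
  trans (Tᵘ-suc-≤0 m (suc e) a b) (cong (λ h → xTimes (Tᵘ m h) a b + Tᵘ m (- + suc (suc e)) a b) (sucℤ-neg e))

Tᵘ-above-support : ∀ m e a b → Tᵘ m (+ suc e) a b ≢ 0 → m ≡ 2 * (a + b) + e × 2 * a + e ≤ m
Tᵘ-below-support : ∀ m e a b → Tᵘ m (- + e) a b ≢ 0 → suc (m + e) ≡ 2 * (a + b) × 2 * b + suc e ≤ m
Tᵘ-above-support zero zero zero zero _ = refl , z≤n
Tᵘ-above-support zero zero zero (suc b) T≢0 = ⊥-elim (T≢0 refl)
Tᵘ-above-support zero zero (suc a) b T≢0 = ⊥-elim (T≢0 refl)
Tᵘ-above-support zero (suc e) a b T≢0 = ⊥-elim (T≢0 refl)
Tᵘ-above-support (suc m) e a b T≢0 with +≢0⇒⊎≢0 (yTimes (Tᵘ m (+ suc (suc e))) a b) (Tᵘ m (predℤ (+ suc e)) a b) T≢0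
Tᵘ-above-support (suc m) e a zero T≢0 | inj₁ up≢0 = ⊥-elim (up≢0 refl)
Tᵘ-above-support (suc m) e a (suc b) T≢0 | inj₁ up≢0 with Tᵘ-above-support m (suc e) a b up≢0
... | len , bound = trans (cong suc len) (arith a b e) , m≤n⇒m≤1+n (≤-trans (+-monoʳ-≤ (2 * a) (n≤1+n e)) bound)
  where
  arith : ∀ a b e → suc (2 * (a + b) + suc e) ≡ 2 * (a + suc b) + e
  arith = solve-∀
Tᵘ-above-support (suc m) zero a b T≢0 | inj₂ down≢0 with Tᵘ-below-support m zero a b down≢0
... | len , _ = trans (cong suc (sym (+-identityʳ m))) (trans len (sym (+-identityʳ _))) ,
                ≤-trans (≤-reflexive (+-identityʳ (2 * a))) (≤-trans (*-monoʳ-≤ 2 (m≤m+n a b)) (≤-reflexive (sym len′)))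
  where
  len′ : suc m ≡ 2 * (a + b)
  len′ = trans (cong suc (sym (+-identityʳ m))) len
Tᵘ-above-support (suc m) (suc e) a b T≢0 | inj₂ down≢0 with Tᵘ-above-support m e a b down≢0
... | len , bound = trans (cong suc len) (sym (+-suc _ e)) , ≤-trans (≤-reflexive (+-suc _ e)) (s≤s bound)
Tᵘ-below-support zero zero a b T≢0 = ⊥-elim (T≢0 refl)
Tᵘ-below-support zero (suc e) a b T≢0 = ⊥-elim (T≢0 refl)
Tᵘ-below-support (suc m) zero a b T≢0 with +≢0⇒⊎≢0 (xTimes (Tᵘ m (+ 1)) a b) (Tᵘ m (- + 1) a b) T≢0
Tᵘ-below-support (suc m) zero zero b T≢0 | inj₁ up≢0 = ⊥-elim (up≢0 refl)
Tᵘ-below-support (suc m) zero (suc a) b T≢0 | inj₁ up≢0 with Tᵘ-above-support m zero a b up≢0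
... | len , _ = trans (cong (λ k → suc (suc k)) (+-identityʳ m)) (trans (cong (λ k → suc (suc k)) len) (arith a b)) ,
                ≤-trans (≤-reflexive (+-suc (2 * b) 0)) (s≤s (≤-trans (bound a b) (≤-reflexive (sym len))))
  where
  arith : ∀ a b → suc (suc (2 * (a + b) + 0)) ≡ 2 * (suc a + b)
  arith = solve-∀
  bound : ∀ a b → 2 * b + 0 ≤ 2 * (a + b) + 0
  bound a b = +-monoˡ-≤ 0 (*-monoʳ-≤ 2 (m≤n+m b a))
Tᵘ-below-support (suc m) zero a b T≢0 | inj₂ down≢0 with Tᵘ-below-support m 1 a b down≢0
... | len , bound = trans (cong suc (trans (+-identityʳ (suc m)) (+-comm 1 m))) len ,
                    m≤n⇒m≤1+n (≤-trans (+-monoʳ-≤ (2 * b) (n≤1+n 1)) bound)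
Tᵘ-below-support (suc m) (suc e) a b T≢0
  with +≢0⇒⊎≢0 (xTimes (Tᵘ m (- + e)) a b) (Tᵘ m (- + suc (suc e)) a b) (subst (_≢ 0) (Tᵘ-suc-<0 m e a b) T≢0)
Tᵘ-below-support (suc m) (suc e) zero b T≢0 | inj₁ up≢0 = ⊥-elim (up≢0 refl)
Tᵘ-below-support (suc m) (suc e) (suc a) b T≢0 | inj₁ up≢0 with Tᵘ-below-support m e a b up≢0
... | len , bound = trans (cong (λ k → suc (suc k)) (+-suc m e)) (trans (cong (λ k → suc (suc k)) len) (arith a b)) ,
                    ≤-trans (≤-reflexive (+-suc _ (suc e))) (s≤s bound)
  where
  arith : ∀ a b → suc (suc (2 * (a + b))) ≡ 2 * (suc a + b)
  arith = solve-∀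
Tᵘ-below-support (suc m) (suc e) a b T≢0 | inj₂ down≢0 with Tᵘ-below-support m (suc (suc e)) a b down≢0
... | len , bound = trans (cong suc (sym (+-suc m (suc e)))) len ,
                    m≤n⇒m≤1+n (≤-trans (+-monoʳ-≤ (2 * b) (n≤1+n (suc (suc e)))) bound)

Tᵘ-above≡0 : ∀ m e a b → ¬ (m ≡ 2 * (a + b) + e × 2 * a + e ≤ m) → Tᵘ m (+ suc e) a b ≡ 0
Tᵘ-above≡0 m e a b ¬supp = ≢0-stable (λ T≢0 → ¬supp (Tᵘ-above-support m e a b T≢0))

Tᵘ-below≡0 : ∀ m e a b → ¬ (suc (m + e) ≡ 2 * (a + b) × 2 * b + suc e ≤ m) → Tᵘ m (- + e) a b ≡ 0
Tᵘ-below≡0 m e a b ¬supp = ≢0-stable (λ T≢0 → ¬supp (Tᵘ-below-support m e a b T≢0))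

-- A path whose up steps all start at or below the axis, extended by a final up step, is a first passage to height 1.
Tᵘ-x-only : ∀ m a → Tᵘ m (+ 1) a 0 ≡ firstPass (suc m) (+ 0) (suc a)
Tᵘ-below-x-only : ∀ m e a → Tᵘ m (- + e) a 0 ≡ firstPass (suc m) (- + suc e) (suc a)
Tᵘ-x-only zero zero = refl
Tᵘ-x-only zero (suc a) = refl
Tᵘ-x-only (suc m) a = trans (Tᵘ-below-x-only m 0 a) (sym (+-identityʳ _))
Tᵘ-below-x-only zero zero a = refl
Tᵘ-below-x-only zero (suc e) a = refl
Tᵘ-below-x-only (suc m) zero a =
  trans (cong₂ _+_ (up a) (Tᵘ-below-x-only m 1 a)) (+-comm (firstPass (suc m) (+ 0) a) _)
  where
  up : ∀ a → xTimes (Tᵘ m (+ 1)) a 0 ≡ firstPass (suc m) (+ 0) a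
  up zero = sym (firstPass-below≡0 (suc m) 0 0 z≤n)
  up (suc a) = Tᵘ-x-only m a
Tᵘ-below-x-only (suc m) (suc e) a = begin
  Tᵘ (suc m) (- + suc e) a 0
    ≡⟨ Tᵘ-suc-<0 m e a 0 ⟩
  xTimes (Tᵘ m (- + e)) a 0 + Tᵘ m (- + suc (suc e)) a 0
    ≡⟨ cong₂ _+_ (up a) (Tᵘ-below-x-only m (suc (suc e)) a) ⟩
  firstPass (suc m) (- + suc e) a + firstPass (suc m) (- + suc (suc (suc e))) (suc a)
    ≡⟨ +-comm (firstPass (suc m) (- + suc e) a) _ ⟩
  firstPass (suc m) (- + suc (suc (suc e))) (suc a) + firstPass (suc m) (- + suc e) a
    ≡⟨ sym (firstPass-suc-<0 (suc m) (suc e) (suc a)) ⟩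
  firstPass (suc (suc m)) (- + suc (suc e)) (suc a) ∎
  where
  open ≡-Reasoning
  up : ∀ a → xTimes (Tᵘ m (- + e)) a 0 ≡ firstPass (suc m) (- + suc e) a
  up zero = sym (firstPass-below≡0 (suc m) (suc e) 0 z≤n)
  up (suc a) = Tᵘ-below-x-only m e a

-- loops a counts the paths of length 2a from 1 to 1 whose up steps all start at or below the axis.
loops : ℕ → ℕ
loops a = Tᵘ (2 * a) (+ 1) a 0

firstPass-0≡loops : ∀ a → firstPass (suc (2 * a)) (+ 0) (suc a) ≡ loops a
firstPass-0≡loops a = sym (Tᵘ-x-only (2 * a) a)

firstPass-2≡loops : ∀ b → firstPass (suc (2 * b)) (+ 2) b ≡ loops b
firstPass-2≡loops b = trans (firstPass-reflect (suc (2 * b)) 0 b) (firstPass-0≡loops b)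

firstPass-loops-exchange : ∀ a b j j′ → 2 * a + j ≡ 2 * b + j′ →
  firstPass j (+ 2) b * loops a ≡ firstPass j′ (+ 0) (suc a) * loops b
firstPass-loops-exchange a b j j′ eq with j ℕ.≟ suc (2 * b)
... | yes refl = begin
  firstPass (suc (2 * b)) (+ 2) b * loops a        ≡⟨ cong (_* loops a) (firstPass-2≡loops b) ⟩
  loops b * loops a                                ≡⟨ *-comm (loops b) (loops a) ⟩
  loops a * loops b                                ≡⟨ cong (_* loops b) (sym (firstPass-0≡loops a)) ⟩
  firstPass (suc (2 * a)) (+ 0) (suc a) * loops b  ≡⟨ cong (λ k → firstPass k (+ 0) (suc a) * loops b) (sym j′≡1+2a) ⟩
  firstPass j′ (+ 0) (suc a) * loops b             ∎
  where
  open ≡-Reasoning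
  swap : ∀ a b → 2 * a + suc (2 * b) ≡ 2 * b + suc (2 * a)
  swap = solve-∀
  j′≡1+2a : j′ ≡ suc (2 * a)
  j′≡1+2a = +-cancelˡ-≡ (2 * b) j′ (suc (2 * a)) (trans (sym eq) (swap a b))
... | no j≢1+2b = trans (cong (_* loops a) left≡0) (sym (cong (_* loops b) right≡0))
  where
  left≡0 : firstPass j (+ 2) b ≡ 0
  left≡0 = ≢0-stable (λ fp≢0 → j≢1+2b (trans (firstPass-above-support j 1 b fp≢0) (+-comm (2 * b) 1)))
  swap : ∀ a b → 2 * b + suc (2 * a) ≡ 2 * a + suc (2 * b)
  swap = solve-∀
  j′-length : suc (j′ + 0) ≡ 2 * suc a → j′ ≡ suc (2 * a)
  j′-length len = suc-injective (trans (cong suc (sym (+-identityʳ j′))) (trans len (*-suc 2 a)))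
  right≡0 : firstPass j′ (+ 0) (suc a) ≡ 0
  right≡0 = ≢0-stable (λ fp≢0 → j≢1+2b (+-cancelˡ-≡ (2 * a) j (suc (2 * b))
    (trans eq (trans (cong (_+_ (2 * b)) (j′-length (proj₁ (firstPass-below-support j′ 0 (suc a) fp≢0)))) (swap a b)))))

-- Along an antidiagonal a + b = const the coefficients of Tᵘ m h change, when an x is traded for a y (above the
-- axis) or a y for an x (below it), only by a first-passage count times a loop count.
TradeAbove TradeBelow : ℕ → Set
TradeAbove m = ∀ e a b j → m ≡ 2 * a + j →
  Tᵘ m (+ suc e) a b ≡ yTimes (Tᵘ m (+ suc e)) (suc a) b + firstPass j (+ suc e) b * loops a
TradeBelow m = ∀ e a b j → m ≡ 2 * b + j →
  Tᵘ m (- + e) a b ≡ xTimes (Tᵘ m (- + e)) a (suc b) + firstPass j (- + e) a * loops b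

Tᵘ-1-antidiagonal : ∀ m → TradeAbove m → ∀ c k → m ≡ 2 * (k + c) → Tᵘ m (+ 1) k c ≡ Tᵘ m (+ 1) (k + c) 0
Tᵘ-1-antidiagonal m above zero k eq = cong (λ a → Tᵘ m (+ 1) a 0) (sym (+-identityʳ k))
Tᵘ-1-antidiagonal m above (suc c) k eq = begin
  Tᵘ m (+ 1) k (suc c)                   ≡⟨ above 0 k (suc c) (2 * suc c) (trans eq (*-distribˡ-+ 2 k (suc c))) ⟩
  Tᵘ m (+ 1) (suc k) c + 0 * loops k     ≡⟨ +-identityʳ _ ⟩
  Tᵘ m (+ 1) (suc k) c                   ≡⟨ Tᵘ-1-antidiagonal m above c (suc k) (trans eq (cong (2 *_) (+-suc k c))) ⟩
  Tᵘ m (+ 1) (suc k + c) 0               ≡⟨ cong (λ a → Tᵘ m (+ 1) a 0) (sym (+-suc k c)) ⟩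
  Tᵘ m (+ 1) (k + suc c) 0               ∎
  where open ≡-Reasoning

tradeAbove-suc-≥2 : ∀ m → TradeAbove m → ∀ e a b j → suc m ≡ 2 * a + j →
  Tᵘ (suc m) (+ suc (suc e)) a b ≡ yTimes (Tᵘ (suc m) (+ suc (suc e))) (suc a) b + firstPass j (+ suc (suc e)) b * loops a
tradeAbove-suc-≥2 m above e a b zero eq =
  trans (Tᵘ-above≡0 (suc m) (suc e) a b (λ (len , _) → m+1+n≢m (2 * a + 0) (sym (trans (sym eq) (trans len (arith a b e))))))
        (sym (trans (+-identityʳ _) (shifted b)))
  where
  arith : ∀ a b e → 2 * (a + b) + suc e ≡ (2 * a + 0) + suc (2 * b + e)
  arith = solve-∀
  arith′ : ∀ a b e → 2 * (suc a + b) + suc e ≡ (2 * a + 0) + suc (suc (suc (2 * b + e)))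
  arith′ = solve-∀
  shifted : ∀ b → yTimes (Tᵘ (suc m) (+ suc (suc e))) (suc a) b ≡ 0
  shifted zero = refl
  shifted (suc b) = Tᵘ-above≡0 (suc m) (suc e) (suc a) b
    (λ (len , _) → m+1+n≢m (2 * a + 0) (sym (trans (sym eq) (trans len (arith′ a b e)))))
tradeAbove-suc-≥2 m above e a zero (suc j) eq =
  trans (above e a 0 j (suc≡+suc⇒≡ (2 * a) j eq)) (cong (_* loops a) (sym (+-identityʳ (firstPass j (+ suc e) 0))))
tradeAbove-suc-≥2 m above e a (suc b) (suc j) eq =
  trans (cong₂ _+_ (above (suc (suc e)) a b j m≡) (above e a (suc b) j m≡))
        (+-*-regroup′ _ (Tᵘ m (+ suc e) (suc a) b) (firstPass j (+ suc (suc (suc e))) b) (firstPass j (+ suc e) (suc b)) (loops a))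
  where
  m≡ : m ≡ 2 * a + j
  m≡ = suc≡+suc⇒≡ (2 * a) j eq

-- The trade below the axis at height 0, with its correction rewritten as the one above the axis at height 2.
Tᵘ-0-trade : ∀ m → TradeBelow m → ∀ a b j → m ≡ 2 * a + j →
  Tᵘ m (+ 0) (suc a) b ≡ Tᵘ m (+ 0) a (suc b) + firstPass j (+ 2) b * loops a
Tᵘ-0-trade m below a b j m≡ with 2 * b ℕ.≤? m
... | yes 2b≤m with m≤n⇒∃[o]m+o≡n 2b≤m
...   | j′ , m≡′ = trans (below 0 (suc a) b j′ (sym m≡′))
                         (cong (_+_ (Tᵘ m (+ 0) a (suc b))) (sym (firstPass-loops-exchange a b j j′ (trans (sym m≡) (sym m≡′)))))
Tᵘ-0-trade m below a b j m≡ | no 2b≰m =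
  trans (Tᵘ-below≡0 m 0 (suc a) b (λ (_ , bound) → 2b≰m (≤-trans (m≤m+n (2 * b) 1) bound)))
        (sym (cong₂ _+_ (Tᵘ-below≡0 m 0 a (suc b) too-short) (cong (_* loops a) fp≡0)))
  where
  too-short : ¬ (suc (m + 0) ≡ 2 * (a + suc b) × 2 * suc b + 1 ≤ m)
  too-short (_ , bound) = 2b≰m (≤-trans (*-monoʳ-≤ 2 (n≤1+n b)) (≤-trans (m≤m+n (2 * suc b) 1) bound))
  fp≡0 : firstPass j (+ 2) b ≡ 0
  fp≡0 = ≢0-stable (λ fp≢0 → 2b≰m (subst (2 * b ≤_) (sym m≡) (≤-trans (m≤m+n (2 * b) 1)
           (≤-trans (m≤n+m _ (2 * a)) (≤-reflexive (cong (_+_ (2 * a)) (sym (firstPass-above-support j 1 b fp≢0))))))))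

tradeAbove-suc-1 : ∀ m → TradeAbove m → TradeBelow m → ∀ a b j → suc m ≡ 2 * a + j →
  Tᵘ (suc m) (+ 1) a b ≡ yTimes (Tᵘ (suc m) (+ 1)) (suc a) b + firstPass j (+ 1) b * loops a
tradeAbove-suc-1 m above below a zero zero eq =
  sym (trans (*-identityˡ (loops a)) (cong (λ k → Tᵘ k (+ 1) a 0) (trans (sym (+-identityʳ (2 * a))) (sym eq))))
tradeAbove-suc-1 m above below a (suc b) zero eq =
  trans (Tᵘ-above≡0 (suc m) 0 a (suc b) (λ (len , _) → m+1+n≢m (2 * a + 0) (sym (trans (sym eq) (trans len (arith a b))))))
        (sym (trans (+-identityʳ _) (Tᵘ-above≡0 (suc m) 0 (suc a) b
          (λ (len , _) → m+1+n≢m (2 * a + 0) (sym (trans (sym eq) (trans len (arith′ a b))))))))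
  where
  arith : ∀ a b → 2 * (a + suc b) + 0 ≡ (2 * a + 0) + suc (suc (2 * b))
  arith = solve-∀
  arith′ : ∀ a b → 2 * (suc a + b) + 0 ≡ (2 * a + 0) + suc (suc (2 * b))
  arith′ = solve-∀
tradeAbove-suc-1 m above below a zero (suc j) eq =
  Tᵘ-below≡0 m 0 a 0 (λ (len , _) → m+1+n≢m (2 * (a + 0)) (trans (sym (arith a j)) (trans (cong (λ k → suc (k + 0)) (sym m≡)) len)))
  where
  m≡ : m ≡ 2 * a + j
  m≡ = suc≡+suc⇒≡ (2 * a) j eq
  arith : ∀ a j → suc (2 * a + j + 0) ≡ 2 * (a + 0) + suc (j + 0)
  arith = solve-∀
tradeAbove-suc-1 m above below a (suc b) (suc j) eq = begin
  Tᵘ m (+ 2) a b + Tᵘ m (+ 0) a (suc b)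
    ≡⟨ cong (_+ Tᵘ m (+ 0) a (suc b)) (above 1 a b j m≡) ⟩
  (Y + firstPass j (+ 2) b * loops a) + Tᵘ m (+ 0) a (suc b)
    ≡⟨ rearrange Y (firstPass j (+ 2) b * loops a) (Tᵘ m (+ 0) a (suc b)) ⟩
  Y + (Tᵘ m (+ 0) a (suc b) + firstPass j (+ 2) b * loops a)
    ≡⟨ cong (_+_ Y) (sym (Tᵘ-0-trade m below a b j m≡)) ⟩
  Y + Tᵘ m (+ 0) (suc a) b
    ≡⟨ sym (+-identityʳ _) ⟩
  (Y + Tᵘ m (+ 0) (suc a) b) + 0 ∎
  where
  open ≡-Reasoning
  Y : ℕ
  Y = yTimes (Tᵘ m (+ 2)) (suc a) b
  m≡ : m ≡ 2 * a + j
  m≡ = suc≡+suc⇒≡ (2 * a) j eq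
  rearrange : ∀ x k y → (x + k) + y ≡ x + (y + k)
  rearrange = solve-∀

tradeAbove-suc : ∀ m → TradeAbove m → TradeBelow m → TradeAbove (suc m)
tradeAbove-suc m above below zero = tradeAbove-suc-1 m above below
tradeAbove-suc m above below (suc e) = tradeAbove-suc-≥2 m above e

tradeBelow-at-1 : ∀ m → TradeAbove m → ∀ a b j → m ≡ 2 * b + j →
  Tᵘ m (+ 1) a b ≡ xTimes (Tᵘ m (+ 1)) a (suc b) + firstPass j (+ 1) a * loops b
tradeBelow-at-1 m above zero b zero eq =
  trans (Tᵘ-1-antidiagonal m above b 0 (trans eq (+-identityʳ _)))
        (trans (cong (λ k → Tᵘ k (+ 1) b 0) (trans eq (+-identityʳ (2 * b)))) (sym (*-identityˡ (loops b))))
tradeBelow-at-1 m above zero b (suc j) eq =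
  Tᵘ-above≡0 m 0 0 b (λ (len , _) → m+1+n≢m (2 * (0 + b) + 0) (trans (sym (arith b j)) (trans (sym eq) len)))
  where
  arith : ∀ b j → 2 * b + suc j ≡ (2 * (0 + b) + 0) + suc j
  arith = solve-∀
tradeBelow-at-1 m above (suc a) b j eq = trans left (sym right)
  where
  right : xTimes (Tᵘ m (+ 1)) (suc a) (suc b) + firstPass j (+ 1) (suc a) * loops b ≡ Tᵘ m (+ 1) a (suc b)
  right = trans (cong (λ k → Tᵘ m (+ 1) a (suc b) + k * loops b) (firstPass-at-1 j a)) (+-identityʳ _)
  left : Tᵘ m (+ 1) (suc a) b ≡ Tᵘ m (+ 1) a (suc b)
  left with 2 * a ℕ.≤? m
  ... | yes 2a≤m with m≤n⇒∃[o]m+o≡n 2a≤m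
  ...   | j′ , m≡′ = sym (trans (above 0 a (suc b) j′ (sym m≡′))
                                (trans (cong (λ k → Tᵘ m (+ 1) (suc a) b + k * loops a) (firstPass-at-1 j′ b)) (+-identityʳ _)))
  left | no 2a≰m =
    trans (Tᵘ-above≡0 m 0 (suc a) b (λ (_ , bound) → 2a≰m (≤-trans (*-monoʳ-≤ 2 (n≤1+n a)) (≤-trans (m≤m+n (2 * suc a) 0) bound))))
          (sym (Tᵘ-above≡0 m 0 a (suc b) (λ (_ , bound) → 2a≰m (≤-trans (m≤m+n (2 * a) 0) bound))))

tradeBelow-suc : ∀ m → TradeAbove m → TradeBelow m → TradeBelow (suc m)
tradeBelow-suc m above below e a b zero eq =
  trans (Tᵘ-below≡0 (suc m) e a b too-short) (sym (cong₂ _+_ (shifted a) (cong (_* loops b) (firstPass-zero-below e a))))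
  where
  too-short : ¬ (suc (suc m + e) ≡ 2 * (a + b) × 2 * b + suc e ≤ suc m)
  too-short (_ , bound) = m+1+n≰m (2 * b) (subst (2 * b + suc e ≤_) (trans eq (+-identityʳ _)) bound)
  arith : ∀ b e → 2 * suc b + suc e ≡ 2 * b + suc (suc (suc e))
  arith = solve-∀
  shifted : ∀ a → xTimes (Tᵘ (suc m) (- + e)) a (suc b) ≡ 0
  shifted zero = refl
  shifted (suc a) = Tᵘ-below≡0 (suc m) e a (suc b)
    (λ (_ , bound) → m+1+n≰m (2 * b) (subst₂ _≤_ (arith b e) (trans eq (+-identityʳ _)) bound))
tradeBelow-suc m above below e zero b (suc j) eq =
  trans (Tᵘ-suc-≤0 m e 0 b)
        (trans (below (suc e) 0 b j (suc≡+suc⇒≡ (2 * b) j eq)) (cong (_* loops b) (sym (trans (firstPass-suc-≤0 j e 0) (+-identityʳ _)))))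
tradeBelow-suc m above below e (suc a) b (suc j) eq = begin
  Tᵘ (suc m) (- + e) (suc a) b
    ≡⟨ Tᵘ-suc-≤0 m e (suc a) b ⟩
  Tᵘ m h₊ a b + Tᵘ m (- + suc e) (suc a) b
    ≡⟨ cong₂ _+_ (from-h₊ e) (below (suc e) (suc a) b j m≡) ⟩
  (xTimes (Tᵘ m h₊) a (suc b) + firstPass j h₊ a * loops b) + (Tᵘ m (- + suc e) a (suc b) + firstPass j (- + suc e) (suc a) * loops b)
    ≡⟨ +-*-regroup′ (xTimes (Tᵘ m h₊) a (suc b)) (Tᵘ m (- + suc e) a (suc b)) (firstPass j h₊ a) (firstPass j (- + suc e) (suc a)) (loops b) ⟩
  (xTimes (Tᵘ m h₊) a (suc b) + Tᵘ m (- + suc e) a (suc b)) + (firstPass j (- + suc e) (suc a) + firstPass j h₊ a) * loops b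
    ≡⟨ sym (cong₂ _+_ (Tᵘ-suc-≤0 m e a (suc b)) (cong (_* loops b) (firstPass-suc-≤0 j e (suc a)))) ⟩
  Tᵘ (suc m) (- + e) a (suc b) + firstPass (suc j) (- + e) (suc a) * loops b ∎
  where
  open ≡-Reasoning
  h₊ : ℤ
  h₊ = sucℤ (- + e)
  m≡ : m ≡ 2 * b + j
  m≡ = suc≡+suc⇒≡ (2 * b) j eq
  from-h₊ : ∀ e → Tᵘ m (sucℤ (- + e)) a b ≡ xTimes (Tᵘ m (sucℤ (- + e))) a (suc b) + firstPass j (sucℤ (- + e)) a * loops b
  from-h₊ zero = tradeBelow-at-1 m above a b j m≡
  from-h₊ (suc e) rewrite sucℤ-neg e = below e a b j m≡

tradeAbove-zero : TradeAbove 0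
tradeAbove-zero zero zero zero zero eq = refl
tradeAbove-zero zero zero (suc b) zero eq = refl
tradeAbove-zero (suc e) zero zero zero eq = refl
tradeAbove-zero (suc e) zero (suc b) zero eq = refl
tradeAbove-zero e zero b (suc j) ()
tradeAbove-zero e (suc a) b j ()

tradeBelow-zero : TradeBelow 0
tradeBelow-zero zero zero zero zero eq = refl
tradeBelow-zero zero (suc a) zero zero eq = refl
tradeBelow-zero (suc e) zero zero zero eq = refl
tradeBelow-zero (suc e) (suc a) zero zero eq = refl
tradeBelow-zero e a zero (suc j) ()
tradeBelow-zero e a (suc b) j ()

trades : ∀ m → TradeAbove m × TradeBelow m
trades zero = tradeAbove-zero , tradeBelow-zero
trades (suc m) with trades m
... | above , below = tradeAbove-suc m above below , tradeBelow-suc m above below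

Tᵘ-diagonal : ∀ {n} a b → a + b ≡ n → Tᵘ (2 * n) (+ 1) a b ≡ loops n
Tᵘ-diagonal a b refl = Tᵘ-1-antidiagonal (2 * (a + b)) (proj₁ (trades (2 * (a + b)))) b a refl

Tᵘ-uniform : ∀ n a b → Tᵘ (2 * n) (+ 1) a b ≡ loops n * δ n (a + b)
Tᵘ-uniform n a b with n ℕ.≟ a + b
... | yes refl = trans (Tᵘ-diagonal a b refl) (sym (*-identityʳ (loops (a + b))))
... | no n≢a+b = trans (Tᵘ-above≡0 (2 * n) 0 a b off) (sym (*-zeroʳ (loops n)))
  where
  off : ¬ (2 * n ≡ 2 * (a + b) + 0 × 2 * a + 0 ≤ 2 * n)
  off (len , _) = n≢a+b (*-cancelˡ-≡ n (a + b) 2 (trans len (+-identityʳ _)))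

-- m − n, by structural recursion so that sucℤ and predℤ compute on it (unlike on ℤ._⊖_).
diff : ℕ → ℕ → ℤ
diff m zero = + m
diff zero (suc n) = -[1+ n ]
diff (suc m) (suc n) = diff m n

predℤ-diff : ∀ m n → predℤ (diff m n) ≡ diff m (suc n)
predℤ-diff zero zero = refl
predℤ-diff (suc m) zero = refl
predℤ-diff zero (suc n) = refl
predℤ-diff (suc m) (suc n) = predℤ-diff m n

sucℤ-diff : ∀ m n → sucℤ (diff m n) ≡ diff (suc m) n
sucℤ-diff m zero = refl
sucℤ-diff zero (suc zero) = refl
sucℤ-diff zero (suc (suc n)) = refl
sucℤ-diff (suc m) (suc n) = sucℤ-diff m n

diff-suc-self : ∀ x → diff (suc x) x ≡ + 1
diff-suc-self zero = refl
diff-suc-self (suc x) = diff-suc-self x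

degreeSum-Tᵘ : ∀ m d → degreeSum d (Tᵘ m (diff (suc m) (2 * d))) ≡ m C d
degreeSum-Tᵘ zero zero = refl
degreeSum-Tᵘ zero (suc d) rewrite +-suc d (d + 0) = sumTo-zero (suc d) (λ _ _ → refl)
degreeSum-Tᵘ (suc m) d = begin
  degreeSum d (Tᵘ (suc m) h)
    ≡⟨ degreeSum-+ d (xOrY (onOrBelow h) ·ˢ Tᵘ m (sucℤ h)) (Tᵘ m (predℤ h)) ⟩
  degreeSum d (xOrY (onOrBelow h) ·ˢ Tᵘ m (sucℤ h)) + degreeSum d (Tᵘ m (predℤ h))
    ≡⟨ cong₂ _+_ (degreeSum-xOrY (onOrBelow h) (Tᵘ m (sucℤ h)) d)
                 (trans (cong (λ g → degreeSum d (Tᵘ m g)) (predℤ-diff (suc (suc m)) (2 * d))) (degreeSum-Tᵘ m d)) ⟩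
  tTimes (λ d′ → degreeSum d′ (Tᵘ m (sucℤ h))) d + m C d
    ≡⟨ pascal d ⟩
  suc m C d ∎
  where
  open ≡-Reasoning
  h = diff (suc (suc m)) (2 * d)
  pascal : ∀ d → tTimes (λ d′ → degreeSum d′ (Tᵘ m (sucℤ (diff (suc (suc m)) (2 * d))))) d + m C d ≡ suc m C d
  pascal zero = refl
  pascal (suc d) rewrite +-suc d (d + 0) =
    trans (cong (_+ m C suc d) (trans (cong (λ g → degreeSum d (Tᵘ m g)) (sucℤ-diff m (2 * d))) (degreeSum-Tᵘ m d)))
          (nCk+nC[k+1]≡[n+1]C[k+1] m d)

loops-central-binomial : ∀ n → suc n * loops n ≡ (2 * n) C n
loops-central-binomial n = begin
  suc n * loops n
    ≡⟨ sym (sumTo-const n (loops n)) ⟩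
  sumTo n (λ _ → loops n)
    ≡⟨ sumTo-cong n (λ i i≤n → sym (Tᵘ-diagonal i (n ∸ i) (m+[n∸m]≡n i≤n))) ⟩
  degreeSum n (Tᵘ (2 * n) (+ 1))
    ≡⟨ cong (λ h → degreeSum n (Tᵘ (2 * n) h)) (sym (diff-suc-self (2 * n))) ⟩
  degreeSum n (Tᵘ (2 * n) (diff (suc (2 * n)) (2 * n)))
    ≡⟨ degreeSum-Tᵘ (2 * n) n ⟩
  (2 * n) C n ∎
  where open ≡-Reasoning

Catalan≡loops : ∀ n → Catalan n ≡ loops n
Catalan≡loops n = begin
  ((2 * n) C n) / suc n      ≡⟨ cong (_/ suc n) (sym (loops-central-binomial n)) ⟩
  (suc n * loops n) / suc n  ≡⟨ cong (_/ suc n) (*-comm (suc n) (loops n)) ⟩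
  (loops n * suc n) / suc n  ≡⟨ m*n/n≡m (loops n) (suc n) ⟩
  loops n ∎
  where open ≡-Reasoning

xf-coefficient : ∀ a b → xf a b ≡ xTimes (homSum 1 Catalan) a b
xf-coefficient zero b = sumTo-zero b (λ n _ → series-startsWith (stepWeight-obeys U) U (2 * n) 0 b)
xf-coefficient (suc a) b = begin
  xf (suc a) b
    ≡⟨ sumTo-cong (suc (a + b)) (λ n _ → trans (series-startsWith (stepWeight-obeys U) U (2 * n) (suc a) b) (Tᵘ-uniform n a b)) ⟩
  sumTo (suc (a + b)) (λ n → loops n * δ n (a + b))
    ≡⟨ cong (_+_ _) (*δ-≢ (loops (suc (a + b))) 1+n≢n) ⟩
  sumTo (a + b) (λ n → loops n * δ n (a + b)) + 0
    ≡⟨ +-identityʳ _ ⟩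
  sumTo (a + b) (λ n → loops n * δ n (a + b))
    ≡⟨ sumTo-cong (a + b) (λ n _ → cong₂ (λ c k → c * δ k (a + b)) (sym (Catalan≡loops n)) (sym (*-identityˡ n))) ⟩
  sumTo (a + b) (λ n → Catalan n * δ (1 * n) (a + b))
    ≡⟨ sym (homSum-diagonal 1 Catalan a b) ⟩
  homSum 1 Catalan a b ∎
  where open ≡-Reasoning

-- Weighted down steps

Tᵈ : ℕ → ℤ → Series
Tᵈ = transfer (stepRule D)

Tᵈ-≥0-support : ∀ m e a b → Tᵈ m (+ e) a b ≢ 0 → m + e ≡ suc (2 * (a + b))
Tᵈ-<0-support : ∀ m n a b → Tᵈ m -[1+ n ] a b ≢ 0 → m ≡ 2 * (a + b) + suc (suc n)
Tᵈ-≥0-support zero zero a b T≢0 = ⊥-elim (T≢0 refl)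
Tᵈ-≥0-support zero (suc zero) zero zero T≢0 = refl
Tᵈ-≥0-support zero (suc zero) zero (suc b) T≢0 = ⊥-elim (T≢0 refl)
Tᵈ-≥0-support zero (suc zero) (suc a) b T≢0 = ⊥-elim (T≢0 refl)
Tᵈ-≥0-support zero (suc (suc e)) a b T≢0 = ⊥-elim (T≢0 refl)
Tᵈ-≥0-support (suc m) e a b T≢0 with +≢0⇒⊎≢0 (Tᵈ m (+ suc e) a b) _ T≢0
Tᵈ-≥0-support (suc m) e a b T≢0 | inj₁ up≢0 = trans (sym (+-suc m e)) (Tᵈ-≥0-support m (suc e) a b up≢0)
Tᵈ-≥0-support (suc m) zero zero b T≢0 | inj₂ down≢0 = ⊥-elim (down≢0 refl)
Tᵈ-≥0-support (suc m) zero (suc a) b T≢0 | inj₂ down≢0 = trans (cong suc (+-identityʳ m))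
    (trans (cong suc (Tᵈ-<0-support m 0 a b down≢0)) (arith a b))
  where
  arith : ∀ a b → suc (2 * (a + b) + 2) ≡ suc (2 * (suc a + b))
  arith = solve-∀
Tᵈ-≥0-support (suc m) (suc e) a zero T≢0 | inj₂ down≢0 = ⊥-elim (down≢0 refl)
Tᵈ-≥0-support (suc m) (suc e) a (suc b) T≢0 | inj₂ down≢0 = trans (cong suc (+-suc m e))
    (trans (cong (λ k → suc (suc k)) (Tᵈ-≥0-support m e a b down≢0)) (arith a b))
  where
  arith : ∀ a b → suc (suc (suc (2 * (a + b)))) ≡ suc (2 * (a + suc b))
  arith = solve-∀
Tᵈ-<0-support zero n a b T≢0 = ⊥-elim (T≢0 refl)
Tᵈ-<0-support (suc m) n a b T≢0 with +≢0⇒⊎≢0 (Tᵈ m (sucℤ -[1+ n ]) a b) (xTimes (Tᵈ m -[1+ suc n ]) a b) T≢0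
Tᵈ-<0-support (suc m) zero a b T≢0 | inj₁ up≢0 = trans (cong suc (sym (+-identityʳ m)))
    (trans (cong suc (Tᵈ-≥0-support m 0 a b up≢0)) (arith a b))
  where
  arith : ∀ a b → suc (suc (2 * (a + b))) ≡ 2 * (a + b) + 2
  arith = solve-∀
Tᵈ-<0-support (suc m) (suc n) a b T≢0 | inj₁ up≢0 = trans (cong suc (Tᵈ-<0-support m n a b up≢0)) (sym (+-suc _ (suc (suc n))))
Tᵈ-<0-support (suc m) n zero b T≢0 | inj₂ down≢0 = ⊥-elim (down≢0 refl)
Tᵈ-<0-support (suc m) n (suc a) b T≢0 | inj₂ down≢0 = trans (cong suc (Tᵈ-<0-support m (suc n) a b down≢0)) (arith a b n)
  where
  arith : ∀ a b n → suc (2 * (a + b) + suc (suc (suc n))) ≡ 2 * (suc a + b) + suc (suc n)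
  arith = solve-∀

-- From height e ≥ 0 an x-weighted down step is only reached after e y-weighted ones.
Tᵈ-≥0-x-support : ∀ m e a b → Tᵈ m (+ e) (suc a) b ≢ 0 → e ≤ b
Tᵈ-≥0-x-support zero zero a b T≢0 = z≤n
Tᵈ-≥0-x-support zero (suc zero) a b T≢0 = ⊥-elim (T≢0 refl)
Tᵈ-≥0-x-support zero (suc (suc e)) a b T≢0 = ⊥-elim (T≢0 refl)
Tᵈ-≥0-x-support (suc m) e a b T≢0 with +≢0⇒⊎≢0 (Tᵈ m (+ suc e) (suc a) b) _ T≢0
... | inj₁ up≢0 = ≤-trans (n≤1+n e) (Tᵈ-≥0-x-support m (suc e) a b up≢0)
Tᵈ-≥0-x-support (suc m) zero a b T≢0 | inj₂ down≢0 = z≤n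
Tᵈ-≥0-x-support (suc m) (suc e) a zero T≢0 | inj₂ down≢0 = ⊥-elim (down≢0 refl)
Tᵈ-≥0-x-support (suc m) (suc e) a (suc b) T≢0 | inj₂ down≢0 = s≤s (Tᵈ-≥0-x-support m e a b down≢0)

Tᵈ-above-no-y : ∀ m e a → Tᵈ (suc m) (+ suc e) a 0 ≡ 0
Tᵈ-above-no-y zero zero zero = refl
Tᵈ-above-no-y zero zero (suc a) = refl
Tᵈ-above-no-y zero (suc e) a = refl
Tᵈ-above-no-y (suc m) e a = trans (+-identityʳ _) (Tᵈ-above-no-y m (suc e) a)

Tᵈ-≥0-one-x : ∀ m e b → Tᵈ (suc (suc m)) (+ e) 1 b ≡ Tᵈ m (+ suc (suc e)) 0 (suc b)
Tᵈ-≥0-one-x zero e b = ≢0-stable (λ T≢0 → bad (Tᵈ-≥0-support 2 e 1 b T≢0) (Tᵈ-≥0-x-support 2 e 0 b T≢0))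
  where
  bad : 2 + e ≡ suc (2 * (1 + b)) → e ≤ b → ⊥
  bad len e≤b = 1+n≰n (≤-trans (s≤s (m≤m+n b (b + 0))) (subst (_≤ b) (suc-injective (suc-injective (trans len (arith b)))) e≤b))
    where
    arith : ∀ b → suc (2 * (1 + b)) ≡ suc (suc (suc (b + (b + 0))))
    arith = solve-∀
Tᵈ-≥0-one-x (suc m) zero b = cong₂ _+_ (Tᵈ-≥0-one-x m 1 b) (trans (+-identityʳ _) (+-identityʳ _))
Tᵈ-≥0-one-x (suc m) (suc e) b = cong₂ _+_ (Tᵈ-≥0-one-x m (suc (suc e)) b) (down b)
  where
  down : ∀ b → yTimes (Tᵈ (suc (suc m)) (+ e)) 1 b ≡ yTimes (Tᵈ m (+ suc (suc e))) 0 (suc b)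
  down zero = sym (≢0-stable (λ T≢0 → bad (Tᵈ-≥0-support m (suc (suc e)) 0 0 T≢0)))
    where
    bad : m + suc (suc e) ≡ suc (2 * (0 + 0)) → ⊥
    bad len with trans (sym (trans (+-suc m (suc e)) (cong suc (+-suc m e)))) len
    ... | ()
  down (suc b) = Tᵈ-≥0-one-x m e b

Tᵈ-suc-≤0 : ∀ j e a b → Tᵈ (suc j) (- + e) a b ≡ Tᵈ j (sucℤ (- + e)) a b + xTimes (Tᵈ j (- + suc e)) a b
Tᵈ-suc-≤0 j zero a b = refl
Tᵈ-suc-≤0 j (suc zero) a b = refl
Tᵈ-suc-≤0 j (suc (suc e)) a b = refl

Tᵈ-zero-below : ∀ e a → Tᵈ 0 (- + e) a 0 ≡ 0
Tᵈ-zero-below zero a = refl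
Tᵈ-zero-below (suc e) a = refl

Tᵈ-1-x-no-y : ∀ j a → Tᵈ j (+ 1) (suc a) 0 ≡ 0
Tᵈ-1-x-no-y zero a = refl
Tᵈ-1-x-no-y (suc j) a = Tᵈ-above-no-y j 0 (suc a)

-- Without y-weighted down steps a path from height ≤ 0 never descends from above the axis, so it first reaches 1 at its end.
Tᵈ-≤0-x-only : ∀ j e a → Tᵈ j (- + e) a 0 ≡ firstPass j (- + e) (a + suc e)
Tᵈ-≤0-x-only zero zero a = refl
Tᵈ-≤0-x-only zero (suc e) a = refl
Tᵈ-≤0-x-only (suc j) e a = trans (Tᵈ-suc-≤0 j e a 0)
    (trans (cong₂ _+_ (up e a) (down a)) (trans (+-comm (firstPass j (sucℤ (- + e)) (a + e)) _) (sym fp-suc)))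
  where
  fp-suc : firstPass (suc j) (- + e) (a + suc e) ≡ firstPass j (- + suc e) (a + suc e) + firstPass j (sucℤ (- + e)) (a + e)
  fp-suc = trans (firstPass-suc-≤0 j e (a + suc e))
      (cong (_+_ (firstPass j (- + suc e) (a + suc e))) (cong (tTimes (firstPass j (sucℤ (- + e)))) (+-suc a e)))
  up : ∀ e a → Tᵈ j (sucℤ (- + e)) a 0 ≡ firstPass j (sucℤ (- + e)) (a + e)
  up zero zero = at-1 j
    where
    at-1 : ∀ j → Tᵈ j (+ 1) 0 0 ≡ firstPass j (+ 1) 0
    at-1 zero = refl
    at-1 (suc j) = Tᵈ-above-no-y j 0 0
  up zero (suc a) = trans (Tᵈ-1-x-no-y j a) (sym (firstPass-at-1 j (a + 0)))
  up (suc e) a rewrite sucℤ-neg e = Tᵈ-≤0-x-only j e a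
  down : ∀ a → xTimes (Tᵈ j (- + suc e)) a 0 ≡ firstPass j (- + suc e) (a + suc e)
  down zero = sym (firstPass-below≡0 j (suc e) (suc e) ≤-refl)
  down (suc a) = trans (Tᵈ-≤0-x-only j (suc e) a) (cong (firstPass j (- + suc e)) (+-suc a (suc e)))

Tᵈ-−1-x-only : ∀ k → Tᵈ (2 * suc k) -[1+ 0 ] k 0 ≡ loops (suc k)
Tᵈ-−1-x-only k = trans (Tᵈ-≤0-x-only (2 * suc k) 1 k) (trans (cong (firstPass (2 * suc k) (- + 1)) (+-comm k 2))
        (trans (sym (trans (cong (_+_ (firstPass (2 * suc k) (- + 1) (suc (suc k)))) (firstPass-at-1 (2 * suc k) k)) (+-identityʳ _)))
            (firstPass-0≡loops (suc k))))

Tᵈ-0-x-only : ∀ a → Tᵈ (suc (2 * suc a)) (+ 0) (suc a) 0 ≡ loops (suc a)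
Tᵈ-0-x-only a = trans (Tᵈ-≤0-x-only (suc (2 * suc a)) 0 (suc a))
    (trans (cong (firstPass (suc (2 * suc a)) (+ 0)) (+-comm (suc a) 1)) (firstPass-0≡loops (suc a)))

-- The analogues of TradeAbove and TradeBelow for weighted down steps; at height −1 the trade is exact.
TradeAboveᵈ TradeBelowᵈ Symmetricᵈ : ℕ → Set
TradeAboveᵈ m = ∀ e a b j → m ≡ 2 * suc a + j →
  Tᵈ m (+ e) (suc a) b ≡ yTimes (Tᵈ m (+ e)) (suc (suc a)) b + firstPass j (- + e) (suc b) * loops (suc a)
TradeBelowᵈ m = ∀ e a b j → m ≡ 2 * suc b + j →
  Tᵈ m -[1+ suc e ] a b ≡ xTimes (Tᵈ m -[1+ suc e ]) a (suc b) + Tᵈ j (- + e) a 0 * loops (suc b)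
Symmetricᵈ m = ∀ a b → Tᵈ m -[1+ 0 ] a (suc b) ≡ Tᵈ m -[1+ 0 ] (suc a) b

Tᵈ-−1-antidiagonal : ∀ m → Symmetricᵈ m → ∀ c a → Tᵈ m -[1+ 0 ] a c ≡ Tᵈ m -[1+ 0 ] (a + c) 0
Tᵈ-−1-antidiagonal m symm zero a = cong (λ k → Tᵈ m -[1+ 0 ] k 0) (sym (+-identityʳ a))
Tᵈ-−1-antidiagonal m symm (suc c) a =
  trans (symm a c) (trans (Tᵈ-−1-antidiagonal m symm c (suc a)) (cong (λ k → Tᵈ m -[1+ 0 ] k 0) (sym (+-suc a c))))

tradeAboveᵈ-suc-≥1 : ∀ m → TradeAboveᵈ m → ∀ e a b j → suc m ≡ 2 * suc a + j →
  Tᵈ (suc m) (+ suc e) (suc a) b ≡ yTimes (Tᵈ (suc m) (+ suc e)) (suc (suc a)) b + firstPass j (- + suc e) (suc b) * loops (suc a)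
tradeAboveᵈ-suc-≥1 m above e a b zero eq = trans (≢0-stable (λ T≢0 → clash b b (Tᵈ-≥0-support (suc m) (suc e) (suc a) b T≢0)
                                                                        (Tᵈ-≥0-x-support (suc m) (suc e) a b T≢0) ≤-refl))
                                                (sym (trans (+-identityʳ _) (shifted b)))
  where
  -- When suc m = 2(a + 1), the length forces e = 2b, while reaching an x-weighted step needs e + 1 ≤ b.
  clash : ∀ c d → suc m + suc e ≡ suc (2 * (suc a + c)) → suc e ≤ d → d ≤ c → ⊥
  clash c d len bound d≤c = 1+n≰n (≤-trans (s≤s (m≤m+n c (c + 0))) (subst (λ k → suc k ≤ c) e≡2c (≤-trans bound d≤c)))
    where
    arith : ∀ a c → suc (2 * (suc a + c)) ≡ (2 * suc a + 0) + suc (2 * c)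
    arith = solve-∀
    e≡2c : e ≡ 2 * c
    e≡2c = suc-injective (+-cancelˡ-≡ (2 * suc a + 0) (suc e) (suc (2 * c)) (trans (trans (cong (_+ suc e) (sym eq)) len) (arith a c)))
  shifted : ∀ b → yTimes (Tᵈ (suc m) (+ suc e)) (suc (suc a)) b ≡ 0
  shifted zero = refl
  shifted (suc b) = ≢0-stable (λ T≢0 → clash (suc b) b
    (trans (Tᵈ-≥0-support (suc m) (suc e) (suc (suc a)) b T≢0) (cong (λ k → suc (2 * k)) (sym (+-suc (suc a) b))))
    (Tᵈ-≥0-x-support (suc m) (suc e) (suc a) b T≢0) (n≤1+n b))
tradeAboveᵈ-suc-≥1 m above e a zero (suc j) eq = begin
  Tᵈ m (+ suc (suc e)) (suc a) 0 + 0
    ≡⟨ +-identityʳ _ ⟩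
  Tᵈ m (+ suc (suc e)) (suc a) 0
    ≡⟨ above (suc (suc e)) a 0 j (suc≡+suc⇒≡ (2 * suc a) j eq) ⟩
  yTimes (Tᵈ m (+ suc (suc e))) (suc (suc a)) 0 + firstPass j (- + suc (suc e)) 1 * loops (suc a)
    ≡⟨ cong (λ k → k * loops (suc a)) (sym fp≡) ⟩
  yTimes (Tᵈ m (+ suc (suc e))) (suc (suc a)) 0 + firstPass (suc j) (- + suc e) 1 * loops (suc a) ∎
  where
  open ≡-Reasoning
  fp≡ : firstPass (suc j) (- + suc e) 1 ≡ firstPass j (- + suc (suc e)) 1
  fp≡ = trans (firstPass-suc-<0 j e 1) (trans (cong (_+_ (firstPass j (- + suc (suc e)) 1)) (firstPass-below≡0 j e 0 z≤n)) (+-identityʳ _))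
tradeAboveᵈ-suc-≥1 m above e a (suc b) (suc j) eq =
  trans (cong₂ _+_ (above (suc (suc e)) a (suc b) j m≡) (above e a b j m≡))
        (trans (+-*-regroup X Y F₁ F₂ (loops (suc a))) (sym (cong (λ k → X + Y + k * loops (suc a)) (firstPass-suc-<0 j e (suc (suc b))))))
  where
  m≡ : m ≡ 2 * suc a + j
  m≡ = suc≡+suc⇒≡ (2 * suc a) j eq
  X Y F₁ F₂ : ℕ
  X = Tᵈ m (+ suc (suc e)) (suc (suc a)) b
  Y = yTimes (Tᵈ m (+ e)) (suc (suc a)) b
  F₁ = firstPass j (- + suc (suc e)) (suc (suc b))
  F₂ = firstPass j (- + e) (suc b)

tradeAboveᵈ-suc-0 : ∀ m → TradeAboveᵈ m → Symmetricᵈ m → ∀ a b j → suc m ≡ 2 * suc a + j →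
  Tᵈ (suc m) (+ 0) (suc a) b ≡ yTimes (Tᵈ (suc m) (+ 0)) (suc (suc a)) b + firstPass j (+ 0) (suc b) * loops (suc a)
tradeAboveᵈ-suc-0 m above symm a b zero eq = trans (≢0-stable (λ T≢0 → odd (suc a + b) (Tᵈ-≥0-support (suc m) 0 (suc a) b T≢0)))
                                                  (sym (trans (+-identityʳ _) (shifted b)))
  where
  odd : ∀ c → suc m + 0 ≡ suc (2 * c) → ⊥
  odd c len = even≢odd (suc a) c (trans (sym (trans eq (+-identityʳ _))) (trans (sym (+-identityʳ (suc m))) len))
  shifted : ∀ b → yTimes (Tᵈ (suc m) (+ 0)) (suc (suc a)) b ≡ 0
  shifted zero = refl
  shifted (suc b) = ≢0-stable (λ T≢0 → odd (suc (suc a) + b) (Tᵈ-≥0-support (suc m) 0 (suc (suc a)) b T≢0))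
tradeAboveᵈ-suc-0 m above symm a zero (suc j) eq =
  trans (cong₂ _+_ (above 1 a 0 j m≡) (from-−1 j m≡)) (sym (*-distribʳ-+ (loops (suc a)) (firstPass j (- + 1) 1) (firstPass j (+ 1) 0)))
  where
  m≡ : m ≡ 2 * suc a + j
  m≡ = suc≡+suc⇒≡ (2 * suc a) j eq
  from-−1 : ∀ j → m ≡ 2 * suc a + j → Tᵈ m -[1+ 0 ] a 0 ≡ firstPass j (+ 1) 0 * loops (suc a)
  from-−1 zero m≡′ = trans (cong (λ k → Tᵈ k -[1+ 0 ] a 0) (trans m≡′ (+-identityʳ _))) (trans (Tᵈ-−1-x-only a) (sym (+-identityʳ _)))
  from-−1 (suc j) m≡′ = ≢0-stable (λ T≢0 → m+1+n≢m (2 * (a + 0) + 2) (trans (arith a j) (trans (sym m≡′) (Tᵈ-<0-support m 0 a 0 T≢0))))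
    where
    arith : ∀ a j → (2 * (a + 0) + 2) + suc j ≡ 2 * suc a + suc j
    arith = solve-∀
tradeAboveᵈ-suc-0 m above symm a (suc b) (suc j) eq =
  trans (cong₂ _+_ (above 1 a (suc b) j (suc≡+suc⇒≡ (2 * suc a) j eq)) (symm a b))
        (trans (rearrange X F Y (loops (suc a))) (cong (λ k → (X + Y) + (F + k) * loops (suc a)) (sym (firstPass-at-1 j b))))
  where
  X Y F : ℕ
  X = Tᵈ m (+ 1) (suc (suc a)) b
  Y = Tᵈ m -[1+ 0 ] (suc a) b
  F = firstPass j (- + 1) (suc (suc b))
  rearrange : ∀ x p y n → (x + p * n) + y ≡ (x + y) + (p + 0) * n
  rearrange = solve-∀

tradeAboveᵈ-suc : ∀ m → TradeAboveᵈ m → Symmetricᵈ m → TradeAboveᵈ (suc m)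
tradeAboveᵈ-suc m above symm zero = tradeAboveᵈ-suc-0 m above symm
tradeAboveᵈ-suc m above symm (suc e) = tradeAboveᵈ-suc-≥1 m above e

tradeBelowᵈ-suc : ∀ m → TradeBelowᵈ m → Symmetricᵈ m → TradeBelowᵈ (suc m)
tradeBelowᵈ-suc m below symm e a b zero eq = trans
    (≢0-stable (λ T≢0 → m+1+n≢m (2 * suc b + 0) (too-long (Tᵈ-<0-support (suc m) (suc e) a b T≢0))))
                                                  (sym (cong₂ _+_ (shifted a) (cong (_* loops (suc b)) (Tᵈ-zero-below e a))))
  where
  too-long : suc m ≡ 2 * (a + b) + suc (suc (suc e)) → (2 * suc b + 0) + suc (2 * a + e) ≡ 2 * suc b + 0
  too-long len = trans (sym (arith a b e)) (trans (sym len) eq)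
    where
    arith : ∀ a b e → 2 * (a + b) + suc (suc (suc e)) ≡ (2 * suc b + 0) + suc (2 * a + e)
    arith = solve-∀
  shifted : ∀ a → xTimes (Tᵈ (suc m) -[1+ suc e ]) a (suc b) ≡ 0
  shifted zero = refl
  shifted (suc a) = ≢0-stable (λ T≢0 → m+1+n≢m (2 * suc b + 0)
      (trans (arith a b e) (trans (sym (Tᵈ-<0-support (suc m) (suc e) a (suc b) T≢0)) eq)))
    where
    arith : ∀ a b e → (2 * suc b + 0) + suc (2 * a + suc (suc e)) ≡ 2 * (a + suc b) + suc (suc (suc e))
    arith = solve-∀
tradeBelowᵈ-suc m below symm (suc e) zero b (suc j) eq =
  trans (+-identityʳ _) (trans (below e 0 b j (suc≡+suc⇒≡ (2 * suc b) j eq))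
    (cong (_* loops (suc b)) (sym (trans (Tᵈ-suc-≤0 j (suc e) 0 0) (trans (+-identityʳ _) (cong (λ h → Tᵈ j h 0 0) (sucℤ-neg e)))))))
tradeBelowᵈ-suc m below symm zero zero b (suc j) eq = trans (+-identityʳ _) (to-0 j (suc≡+suc⇒≡ (2 * suc b) j eq))
  where
  to-0 : ∀ j → m ≡ 2 * suc b + j → Tᵈ m -[1+ 0 ] 0 b ≡ Tᵈ (suc j) (+ 0) 0 0 * loops (suc b)
  to-0 zero m≡ = trans (Tᵈ-−1-antidiagonal m symm b 0)
                       (trans (cong (λ k → Tᵈ k -[1+ 0 ] b 0) (trans m≡ (+-identityʳ _))) (trans (Tᵈ-−1-x-only b) (sym (+-identityʳ _))))
  to-0 (suc j) m≡ = trans (≢0-stable (λ T≢0 → m+1+n≢m (2 * (0 + b) + 2) (trans (arith b j) (trans (sym m≡) (Tᵈ-<0-support m 0 0 b T≢0)))))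
                          (sym (cong (_* loops (suc b)) (trans (+-identityʳ _) (Tᵈ-above-no-y j 0 0))))
    where
    arith : ∀ b j → (2 * (0 + b) + 2) + suc j ≡ 2 * suc b + suc j
    arith = solve-∀
tradeBelowᵈ-suc m below symm e (suc a) b (suc j) eq =
  trans (cong₂ _+_ (from-h₊ e) (below (suc e) a b j m≡))
        (trans (+-*-regroup X Y G₁ G₂ (loops (suc b))) (sym (cong (λ k → (X + Y) + k * loops (suc b)) (Tᵈ-suc-≤0 j e (suc a) 0))))
  where
  m≡ : m ≡ 2 * suc b + j
  m≡ = suc≡+suc⇒≡ (2 * suc b) j eq
  X Y G₁ G₂ : ℕ
  X = Tᵈ m (sucℤ -[1+ suc e ]) a (suc b)
  Y = xTimes (Tᵈ m -[1+ suc (suc e) ]) a (suc b)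
  G₁ = Tᵈ j (sucℤ (- + e)) (suc a) 0
  G₂ = Tᵈ j (- + suc e) a 0
  from-h₊ : ∀ e → Tᵈ m (sucℤ -[1+ suc e ]) (suc a) b ≡ Tᵈ m (sucℤ -[1+ suc e ]) a (suc b) + Tᵈ j (sucℤ (- + e)) (suc a) 0 * loops (suc b)
  from-h₊ zero = trans (sym (symm a b)) (sym
      (trans (cong (λ k → Tᵈ m -[1+ 0 ] a (suc b) + k * loops (suc b)) (Tᵈ-1-x-no-y j a)) (+-identityʳ _)))
  from-h₊ (suc e) rewrite sucℤ-neg e = below e (suc a) b j m≡

-- One step from −1 leads to 0 or −2; the corrections of the two trades there agree: both equal
-- loops (a + 1) · loops (b + 1) on the one antidiagonal where they do not vanish.
symmetricᵈ-suc : ∀ m → TradeAboveᵈ m → TradeBelowᵈ m → Symmetricᵈ (suc m)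
symmetricᵈ-suc zero above below zero b = refl
symmetricᵈ-suc (suc zero) above below zero b = refl
symmetricᵈ-suc (suc (suc m)) above below zero b =
  trans (+-identityʳ _) (trans (+-identityʳ _) (cong₂ _+_ (sym (Tᵈ-≥0-one-x m 0 b)) (sym (trans (+-identityʳ _) (+-identityʳ _)))))
symmetricᵈ-suc m above below (suc a) b with m ℕ.≟ 2 * (a + b) + 5
... | yes m≡ = begin
  (Tᵈ m (+ 0) (suc a) (suc b) + xTimes (Tᵈ m -[1+ 1 ]) (suc a) (suc b))
    ≡⟨ cong (_+ Y) (above 0 a (suc b) (suc (2 * suc b)) (trans m≡ (arith₁ a b))) ⟩
  (X + firstPass (suc (2 * suc b)) (+ 0) (suc (suc b)) * loops (suc a)) + Y
    ≡⟨ cong (λ k → (X + k * loops (suc a)) + Y) (firstPass-0≡loops (suc b)) ⟩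
  (X + loops (suc b) * loops (suc a)) + Y
    ≡⟨ rearrange X Y (loops (suc a)) (loops (suc b)) ⟩
  X + (Y + loops (suc a) * loops (suc b))
    ≡⟨ cong (λ k → X + (Y + k * loops (suc b))) (sym (Tᵈ-0-x-only a)) ⟩
  X + (Y + Tᵈ (suc (2 * suc a)) (+ 0) (suc a) 0 * loops (suc b))
    ≡⟨ cong (_+_ X) (sym (below 0 (suc a) b (suc (2 * suc a)) (trans m≡ (arith₂ a b)))) ⟩
  X + Tᵈ m -[1+ 1 ] (suc a) b ∎
  where
  open ≡-Reasoning
  X Y : ℕ
  X = Tᵈ m (+ 0) (suc (suc a)) b
  Y = xTimes (Tᵈ m -[1+ 1 ]) (suc a) (suc b)
  arith₁ : ∀ a b → 2 * (a + b) + 5 ≡ 2 * suc a + suc (2 * suc b)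
  arith₁ = solve-∀
  arith₂ : ∀ a b → 2 * (a + b) + 5 ≡ 2 * suc b + suc (2 * suc a)
  arith₂ = solve-∀
  rearrange : ∀ x y p q → (x + q * p) + y ≡ x + (y + p * q)
  rearrange = solve-∀
... | no m≢ = trans (cong₂ _+_ (off₁ (suc a) (suc b) (arith₁ a b)) (off₂ a (suc b) (arith₂ a b)))
                    (sym (cong₂ _+_ (off₁ (suc (suc a)) b (arith₃ a b)) (off₂ (suc a) b (arith₄ a b))))
  where
  off₁ : ∀ a′ b′ → suc (2 * (a′ + b′)) ≡ 2 * (a + b) + 5 → Tᵈ m (+ 0) a′ b′ ≡ 0
  off₁ a′ b′ len = ≢0-stable (λ T≢0 → m≢ (trans (sym (+-identityʳ m)) (trans (Tᵈ-≥0-support m 0 a′ b′ T≢0) len)))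
  off₂ : ∀ a′ b′ → 2 * (a′ + b′) + 3 ≡ 2 * (a + b) + 5 → Tᵈ m -[1+ 1 ] a′ b′ ≡ 0
  off₂ a′ b′ len = ≢0-stable (λ T≢0 → m≢ (trans (Tᵈ-<0-support m 1 a′ b′ T≢0) len))
  arith₁ : ∀ a b → suc (2 * (suc a + suc b)) ≡ 2 * (a + b) + 5
  arith₁ = solve-∀
  arith₂ : ∀ a b → 2 * (a + suc b) + 3 ≡ 2 * (a + b) + 5
  arith₂ = solve-∀
  arith₃ : ∀ a b → suc (2 * (suc (suc a) + b)) ≡ 2 * (a + b) + 5
  arith₃ = solve-∀
  arith₄ : ∀ a b → 2 * (suc a + b) + 3 ≡ 2 * (a + b) + 5
  arith₄ = solve-∀

tradesᵈ : ∀ m → TradeAboveᵈ m × TradeBelowᵈ m × Symmetricᵈ m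
tradesᵈ zero = (λ { e a b j () }) , (λ { e a b j () }) , (λ a b → refl)
tradesᵈ (suc m) with tradesᵈ m
... | above , below , symm = tradeAboveᵈ-suc m above symm , tradeBelowᵈ-suc m below symm , symmetricᵈ-suc m above below

Tᵈ-uniform : ∀ n a b → Tᵈ (2 * suc n) -[1+ 0 ] a b ≡ loops (suc n) * δ n (a + b)
Tᵈ-uniform n a b with n ℕ.≟ a + b
... | yes refl = begin
  Tᵈ (2 * suc (a + b)) -[1+ 0 ] a b         ≡⟨ Tᵈ-−1-antidiagonal (2 * suc (a + b)) (proj₂ (proj₂ (tradesᵈ (2 * suc (a + b))))) b a ⟩
  Tᵈ (2 * suc (a + b)) -[1+ 0 ] (a + b) 0   ≡⟨ Tᵈ-−1-x-only (a + b) ⟩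
  loops (suc (a + b))                       ≡⟨ sym (*-identityʳ _) ⟩
  loops (suc (a + b)) * 1                   ∎
  where open ≡-Reasoning
... | no n≢a+b = trans (≢0-stable (λ T≢0 → n≢a+b
    (suc-injective (*-cancelˡ-≡ (suc n) (suc (a + b)) 2 (trans (Tᵈ-<0-support _ 0 a b T≢0) (arith a b))))))
                       (sym (*-zeroʳ (loops (suc n))))
  where
  arith : ∀ a b → 2 * (a + b) + 2 ≡ 2 * suc (a + b)
  arith = solve-∀

xg-coefficient : ∀ a b → xg a b ≡ xTimes (homSum 1 (λ n → Catalan (suc n))) a b
xg-coefficient zero b = sumTo-zero b (λ n _ → series-startsWith (stepWeight-obeys D) D (2 * n) 0 b)
xg-coefficient (suc a) b = begin
  xg (suc a) b
    ≡⟨ sumTo-cong (suc (a + b)) (λ n _ → series-startsWith (stepWeight-obeys D) D (2 * n) (suc a) b) ⟩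
  sumTo (suc (a + b)) (λ n → Tᵈ (2 * n) -[1+ 0 ] a b)
    ≡⟨ sumTo-suc (a + b) (λ n → Tᵈ (2 * n) -[1+ 0 ] a b) ⟩
  sumTo (a + b) (λ n → Tᵈ (2 * suc n) -[1+ 0 ] a b)
    ≡⟨ sumTo-cong (a + b) (λ n _ → trans (Tᵈ-uniform n a b)
         (cong₂ (λ c k → c * δ k (a + b)) (sym (Catalan≡loops (suc n))) (sym (*-identityˡ n)))) ⟩
  sumTo (a + b) (λ n → Catalan (suc n) * δ (1 * n) (a + b))
    ≡⟨ sym (homSum-diagonal 1 (λ n → Catalan (suc n)) a b) ⟩
  homSum 1 (λ n → Catalan (suc n)) a b ∎
  where open ≡-Reasoning

-- Weighted vertices

Tᵛ : ℕ → ℤ → Series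
Tᵛ = transfer vertexRule

Tᵛ-support : ∀ m h a b → Tᵛ m h a b ≢ 0 → a + b ≡ m
Tᵛ-support zero h zero zero _ = refl
Tᵛ-support zero h zero (suc b) T≢0 = ⊥-elim (T≢0 (cong (if_then 1 else 0) (∧-zeroʳ ⌊ h ℤ.≟ + 1 ⌋)))
Tᵛ-support zero h (suc a) b T≢0 = ⊥-elim (T≢0 (cong (if_then 1 else 0) (∧-zeroʳ ⌊ h ℤ.≟ + 1 ⌋)))
Tᵛ-support (suc m) h a b T≢0 with +≢0⇒⊎≢0 ((xOrY (onOrBelow (sucℤ h)) ·ˢ Tᵛ m (sucℤ h)) a b) _ T≢0
... | inj₁ up≢0 = xOrY-support (onOrBelow (sucℤ h)) (Tᵛ m (sucℤ h)) (Tᵛ-support m (sucℤ h)) a b up≢0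
... | inj₂ down≢0 = xOrY-support (onOrBelow (predℤ h)) (Tᵛ m (predℤ h)) (Tᵛ-support m (predℤ h)) a b down≢0

-- firstPass₀ t h counts the paths of length t from h that first reach height 0 at their end.
firstPass₀ : ℕ → ℤ → ℕ
firstPass₀ zero h = if ⌊ h ℤ.≟ + 0 ⌋ then 1 else 0
firstPass₀ (suc t) h = if ⌊ h ℤ.≟ + 0 ⌋ then 0 else (firstPass₀ t (sucℤ h) + firstPass₀ t (predℤ h))

-- staysAbove m e counts the paths of length m from height e to height 1 that never touch the axis.
staysAbove : ℕ → ℕ → ℕ
staysAbove zero zero = 0
staysAbove zero (suc zero) = 1
staysAbove zero (suc (suc e)) = 0
staysAbove (suc m) zero = 0
staysAbove (suc m) (suc e) = staysAbove m (suc (suc e)) + staysAbove m e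

-- loopsᵛ a counts the paths of length a + 1 from 0 to 1 whose vertices other than the last lie at or below the axis.
loopsᵛ : ℕ → ℕ
loopsᵛ a = Tᵛ (suc a) (+ 0) a 1

correctionᵛ : ℕ → ℕ → ℕ → ℕ
correctionᵛ zero zero zero = 1
correctionᵛ zero zero (suc e) = 0
correctionᵛ zero (suc b) e = staysAbove b e
correctionᵛ (suc a) b e = firstPass₀ b (+ suc e) * loopsᵛ a

Tᵛ-suc-<0 : ∀ m e a b → Tᵛ (suc m) -[1+ e ] a b ≡ xTimes (Tᵛ m (sucℤ -[1+ e ])) a b + xTimes (Tᵛ m -[1+ suc e ]) a b
Tᵛ-suc-<0 m zero a b = refl
Tᵛ-suc-<0 m (suc e) a b = refl

Tᵛ-no-y : ∀ m h a → Tᵛ (suc m) h a 0 ≡ 0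
Tᵛ-step-no-y : ∀ m g a → (xOrY (onOrBelow g) ·ˢ (Tᵛ m g)) a 0 ≡ 0
Tᵛ-no-y m h a = cong₂ _+_ (Tᵛ-step-no-y m (sucℤ h) a) (Tᵛ-step-no-y m (predℤ h) a)
Tᵛ-step-no-y m (+ suc n) a = refl
Tᵛ-step-no-y m (+ zero) zero = refl
Tᵛ-step-no-y zero (+ zero) (suc a) = refl
Tᵛ-step-no-y (suc m) (+ zero) (suc a) = Tᵛ-no-y m (+ 0) a
Tᵛ-step-no-y m -[1+ n ] zero = refl
Tᵛ-step-no-y zero -[1+ n ] (suc a) = refl
Tᵛ-step-no-y (suc m) -[1+ n ] (suc a) = Tᵛ-no-y m -[1+ n ] a

staysAbove-0 : ∀ m → staysAbove m 0 ≡ 0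
staysAbove-0 zero = refl
staysAbove-0 (suc m) = refl

Tᵛ-y-only : ∀ m e → Tᵛ m (+ suc e) 0 m ≡ staysAbove m (suc e)
Tᵛ-y-only zero zero = refl
Tᵛ-y-only zero (suc e) = refl
Tᵛ-y-only (suc m) zero = trans (+-identityʳ _)
    (trans (Tᵛ-y-only m 1) (sym (trans (cong (_+_ (staysAbove m 2)) (staysAbove-0 m)) (+-identityʳ _))))
Tᵛ-y-only (suc m) (suc e) = cong₂ _+_ (Tᵛ-y-only m (suc (suc e))) (Tᵛ-y-only m e)

Tᵛ-one-y : ∀ m e → Tᵛ (suc m) (- + e) m 1 ≡ firstPass₀ (suc m) (- + suc e)
Tᵛ-one-y m zero = cong₂ _+_ (at-1 m) (down m 0)
  where
  at-1 : ∀ m → Tᵛ m (+ 1) m 0 ≡ firstPass₀ m (+ 0)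
  at-1 zero = refl
  at-1 (suc m) = Tᵛ-no-y m (+ 1) (suc m)
  down : ∀ m e → xTimes (Tᵛ m (- + suc e)) m 1 ≡ firstPass₀ m (- + suc (suc e))
  down zero e = refl
  down (suc m) e = Tᵛ-one-y m (suc e)
Tᵛ-one-y m (suc e) = trans (Tᵛ-suc-<0 m e m 1) (cong₂ _+_ (up m e) (down m))
  where
  up : ∀ m e → xTimes (Tᵛ m (sucℤ -[1+ e ])) m 1 ≡ firstPass₀ m -[1+ e ]
  up zero e = refl
  up (suc m) e = trans (cong (λ g → Tᵛ (suc m) g m 1) (sucℤ-neg e)) (Tᵛ-one-y m e)
  down : ∀ m → xTimes (Tᵛ m -[1+ suc e ]) m 1 ≡ firstPass₀ m -[1+ suc (suc e) ]
  down zero = refl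
  down (suc m) = Tᵛ-one-y m (suc (suc e))

firstPass₀-reflect : ∀ t n → firstPass₀ t (+ suc n) ≡ firstPass₀ t -[1+ n ]
firstPass₀-reflect zero n = refl
firstPass₀-reflect (suc t) n = trans (cong₂ _+_ (firstPass₀-reflect t (suc n)) (via-0 n)) (+-comm (firstPass₀ t -[1+ suc n ]) _)
  where
  via-0 : ∀ n → firstPass₀ t (+ n) ≡ firstPass₀ t (sucℤ -[1+ n ])
  via-0 zero = refl
  via-0 (suc n) = firstPass₀-reflect t n

firstPass≡firstPass₀ : ∀ j e u → suc (j + e) ≡ 2 * u → firstPass j (- + e) u ≡ firstPass₀ j (- + suc e)
firstPass≡firstPass₀ zero zero u len = refl
firstPass≡firstPass₀ zero (suc e) u len = refl
firstPass≡firstPass₀ (suc j) e u len = trans (firstPass-suc-≤0 j e u)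
    (trans (cong₂ _+_ (firstPass≡firstPass₀ j (suc e) u (trans (cong suc (+-suc j e)) len)) (up e u len))
                    (trans (+-comm (firstPass₀ j (- + suc (suc e))) _) (sym (firstPass₀-suc e))))
  where
  firstPass₀-suc : ∀ e → firstPass₀ (suc j) (- + suc e) ≡ firstPass₀ j (- + e) + firstPass₀ j (- + suc (suc e))
  firstPass₀-suc zero = refl
  firstPass₀-suc (suc e) = refl
  up : ∀ e u → suc (suc j + e) ≡ 2 * u → tTimes (firstPass j (sucℤ (- + e))) u ≡ firstPass₀ j (- + e)
  up e zero ()
  up zero (suc u) len = from-0 j u (suc-injective (trans (cong suc (sym (+-identityʳ (suc j)))) (trans len (arith u))))
    where
    arith : ∀ u → 2 * suc u ≡ suc (suc (2 * u))
    arith = solve-∀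
    from-0 : ∀ j u → suc j ≡ suc (2 * u) → firstPass j (+ 1) u ≡ firstPass₀ j (+ 0)
    from-0 zero zero _ = refl
    from-0 zero (suc u) len with suc-injective len
    ... | ()
    from-0 (suc j) u _ = refl
  up (suc e) (suc u) len rewrite sucℤ-neg e = firstPass≡firstPass₀ j e u
      (suc-injective (suc-injective (trans (cong (λ k → suc (suc k)) (sym (+-suc j e))) (trans len (arith u)))))
    where
    arith : ∀ u → 2 * suc u ≡ suc (suc (2 * u))
    arith = solve-∀

firstPass₀-−1≡loopsᵛ : ∀ t → firstPass₀ (suc t) -[1+ 0 ] ≡ loopsᵛ t
firstPass₀-−1≡loopsᵛ t = sym (Tᵛ-one-y t 0)

firstPass₀-1≡loopsᵛ : ∀ t → firstPass₀ (suc t) (+ 1) ≡ loopsᵛ t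
firstPass₀-1≡loopsᵛ t = trans (firstPass₀-reflect (suc t) 0) (firstPass₀-−1≡loopsᵛ t)

loopsᵛ≡loops : ∀ n → loopsᵛ (2 * n) ≡ loops n
loopsᵛ≡loops n = trans (Tᵛ-one-y (2 * n) 0) (trans (sym (firstPass≡firstPass₀ (suc (2 * n)) 0 (suc n) (arith n))) (firstPass-0≡loops n))
  where
  arith : ∀ n → suc (suc (2 * n) + 0) ≡ 2 * suc n
  arith = solve-∀

-- For vertex weights the trade is exact at height 0, as long as the path keeps a y for its final vertex.
Symmetricᵛ TradeAboveᵛ TradeBelowᵛ : ℕ → Set
Symmetricᵛ m = ∀ a b → a + suc (suc b) ≡ m → Tᵛ m (+ 0) a (suc (suc b)) ≡ Tᵛ m (+ 0) (suc a) (suc b)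
TradeAboveᵛ m = ∀ e a b → a + b ≡ m → Tᵛ m (+ suc e) a b ≡ yTimes (Tᵛ m (+ suc e)) (suc a) b + correctionᵛ a b e
TradeBelowᵛ m = ∀ e a b → a + suc b ≡ m →
  Tᵛ m -[1+ e ] a (suc b) ≡ xTimes (Tᵛ m -[1+ e ]) a (suc (suc b)) + firstPass₀ a -[1+ e ] * loopsᵛ b

Tᵛ-0-antidiagonal : ∀ m → Symmetricᵛ m → ∀ c a → a + suc c ≡ m → Tᵛ m (+ 0) a (suc c) ≡ Tᵛ m (+ 0) (a + c) 1
Tᵛ-0-antidiagonal m symm zero a len = cong (λ k → Tᵛ m (+ 0) k 1) (sym (+-identityʳ a))
Tᵛ-0-antidiagonal m symm (suc c) a len =
  trans (symm a c len) (trans (Tᵛ-0-antidiagonal m symm c (suc a) (trans (sym (+-suc a (suc c))) len))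
                              (cong (λ k → Tᵛ m (+ 0) k 1) (sym (+-suc a c))))

correctionᵛ-0≡ : ∀ a b → correctionᵛ a (suc b) 0 ≡ firstPass₀ a -[1+ 0 ] * loopsᵛ b
correctionᵛ-0≡ zero b = staysAbove-0 b
correctionᵛ-0≡ (suc a) b = begin
  firstPass₀ (suc b) (+ 1) * loopsᵛ a     ≡⟨ cong (_* loopsᵛ a) (firstPass₀-1≡loopsᵛ b) ⟩
  loopsᵛ b * loopsᵛ a                      ≡⟨ *-comm (loopsᵛ b) (loopsᵛ a) ⟩
  loopsᵛ a * loopsᵛ b                      ≡⟨ cong (_* loopsᵛ b) (sym (firstPass₀-−1≡loopsᵛ a)) ⟩
  firstPass₀ (suc a) -[1+ 0 ] * loopsᵛ b  ∎
  where open ≡-Reasoning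

correctionᵛ-suc : ∀ a b e → correctionᵛ a (suc b) (suc e) ≡ correctionᵛ a b (suc (suc e)) + correctionᵛ a b e
correctionᵛ-suc zero zero zero = refl
correctionᵛ-suc zero zero (suc e) = refl
correctionᵛ-suc zero (suc b) e = refl
correctionᵛ-suc (suc a) b e = *-distribʳ-+ (loopsᵛ a) (firstPass₀ b (+ suc (suc (suc e)))) (firstPass₀ b (+ suc e))

symmetricᵛ-suc : ∀ m → TradeAboveᵛ m → TradeBelowᵛ m → Symmetricᵛ (suc m)
symmetricᵛ-suc m above below a b len = begin
  Tᵛ m (+ 1) a (suc b) + X
    ≡⟨ cong (_+ X) (above 0 a (suc b) len′) ⟩
  (Tᵛ m (+ 1) (suc a) b + correctionᵛ a (suc b) 0) + X
    ≡⟨ rearrange (Tᵛ m (+ 1) (suc a) b) (correctionᵛ a (suc b) 0) X ⟩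
  Tᵛ m (+ 1) (suc a) b + (X + correctionᵛ a (suc b) 0)
    ≡⟨ cong (λ k → Tᵛ m (+ 1) (suc a) b + (X + k)) (correctionᵛ-0≡ a b) ⟩
  Tᵛ m (+ 1) (suc a) b + (X + firstPass₀ a -[1+ 0 ] * loopsᵛ b)
    ≡⟨ cong (_+_ (Tᵛ m (+ 1) (suc a) b)) (sym (below 0 a b len′)) ⟩
  Tᵛ m (+ 1) (suc a) b + Tᵛ m -[1+ 0 ] a (suc b) ∎
  where
  open ≡-Reasoning
  X : ℕ
  X = xTimes (Tᵛ m -[1+ 0 ]) a (suc (suc b))
  len′ : a + suc b ≡ m
  len′ = suc-injective (trans (sym (+-suc a (suc b))) len)
  rearrange : ∀ x k y → (x + k) + y ≡ x + (y + k)
  rearrange = solve-∀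

Tᵛ-0-trade : ∀ m → Symmetricᵛ m → ∀ a b → a + b ≡ m →
  correctionᵛ a b 1 + xTimes (Tᵛ m (+ 0)) a (suc b) ≡ Tᵛ m (+ 0) a b + correctionᵛ a (suc b) 0
Tᵛ-0-trade m symm zero zero len = sym (trans (+-identityʳ (Tᵛ m (+ 0) 0 0)) (cong (λ k → Tᵛ k (+ 0) 0 0) (sym len)))
Tᵛ-0-trade m symm zero (suc c) len = begin
  staysAbove c 1 + 0              ≡⟨ +-identityʳ _ ⟩
  staysAbove c 1                  ≡⟨ sym (Tᵛ-y-only c 0) ⟩
  Tᵛ c (+ 1) 0 c                  ≡⟨ sym (+-identityʳ (Tᵛ c (+ 1) 0 c)) ⟩
  Tᵛ (suc c) (+ 0) 0 (suc c)      ≡⟨ cong (λ k → Tᵛ k (+ 0) 0 (suc c)) len ⟩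
  Tᵛ m (+ 0) 0 (suc c)            ≡⟨ sym (+-identityʳ (Tᵛ m (+ 0) 0 (suc c))) ⟩
  Tᵛ m (+ 0) 0 (suc c) + 0        ∎
  where open ≡-Reasoning
Tᵛ-0-trade m symm (suc a) zero len =
  trans (cong (λ k → Tᵛ k (+ 0) a 1) (trans (sym len) (cong suc (+-identityʳ a))))
        (sym (cong₂ _+_ (no-y m len) (*-identityˡ (loopsᵛ a))))
  where
  no-y : ∀ m → suc a + 0 ≡ m → Tᵛ m (+ 0) (suc a) 0 ≡ 0
  no-y (suc m) _ = Tᵛ-no-y m (+ 0) (suc a)
Tᵛ-0-trade m symm (suc a) (suc c) len =
  trans (cong₂ _+_ (cong (_* loopsᵛ a) (sym (+-identityʳ (firstPass₀ (suc c) (+ 2))))) (symm a c (trans (+-suc a (suc c)) len)))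
        (+-comm ((firstPass₀ (suc c) (+ 2) + 0) * loopsᵛ a) (Tᵛ m (+ 0) (suc a) (suc c)))

tradeAboveᵛ-suc : ∀ m → Symmetricᵛ m → TradeAboveᵛ m → TradeAboveᵛ (suc m)
tradeAboveᵛ-suc m symm above (suc e) zero zero len = refl
tradeAboveᵛ-suc m symm above (suc e) (suc a) zero len = refl
tradeAboveᵛ-suc m symm above (suc e) a (suc b) len =
  trans (cong₂ _+_ (above (suc (suc e)) a b len′) (above e a b len′))
        (trans (+-interchange (yTimes (Tᵛ m (+ suc (suc (suc e)))) (suc a) b) (correctionᵛ a b (suc (suc e)))
                              (yTimes (Tᵛ m (+ suc e)) (suc a) b) (correctionᵛ a b e))
               (cong (_+_ _) (sym (correctionᵛ-suc a b e))))
  where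
  len′ : a + b ≡ m
  len′ = suc-injective (trans (sym (+-suc a b)) len)
tradeAboveᵛ-suc m symm above zero (suc a) zero len = no-y m
  where
  no-y : ∀ m → xTimes (Tᵛ m (+ 0)) (suc a) 0 ≡ 0
  no-y zero = refl
  no-y (suc m) = Tᵛ-no-y m (+ 0) a
tradeAboveᵛ-suc m symm above zero a (suc b) len = begin
  Tᵛ m (+ 2) a b + X
    ≡⟨ cong (_+ X) (above 1 a b len′) ⟩
  (Y + correctionᵛ a b 1) + X
    ≡⟨ +-assoc Y (correctionᵛ a b 1) X ⟩
  Y + (correctionᵛ a b 1 + X)
    ≡⟨ cong (_+_ Y) (Tᵛ-0-trade m symm a b len′) ⟩
  Y + (Tᵛ m (+ 0) a b + correctionᵛ a (suc b) 0)
    ≡⟨ sym (+-assoc Y (Tᵛ m (+ 0) a b) _) ⟩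
  (Y + Tᵛ m (+ 0) a b) + correctionᵛ a (suc b) 0 ∎
  where
  open ≡-Reasoning
  X Y : ℕ
  X = xTimes (Tᵛ m (+ 0)) a (suc b)
  Y = yTimes (Tᵛ m (+ 2)) (suc a) b
  len′ : a + b ≡ m
  len′ = suc-injective (trans (sym (+-suc a b)) len)

tradeBelowᵛ-suc : ∀ m → Symmetricᵛ m → TradeBelowᵛ m → TradeBelowᵛ (suc m)
tradeBelowᵛ-suc m symm below e zero b len = Tᵛ-suc-<0 m e 0 (suc b)
tradeBelowᵛ-suc m symm below e (suc a) b len = begin
  Tᵛ (suc m) -[1+ e ] (suc a) (suc b)
    ≡⟨ Tᵛ-suc-<0 m e (suc a) (suc b) ⟩
  Tᵛ m (sucℤ -[1+ e ]) a (suc b) + Tᵛ m -[1+ suc e ] a (suc b)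
    ≡⟨ cong₂ _+_ (from-h₊ e) (below (suc e) a b len′) ⟩
  (X + firstPass₀ a (sucℤ -[1+ e ]) * loopsᵛ b) + (Y + firstPass₀ a -[1+ suc e ] * loopsᵛ b)
    ≡⟨ +-*-regroup X Y (firstPass₀ a (sucℤ -[1+ e ])) (firstPass₀ a -[1+ suc e ]) (loopsᵛ b) ⟩
  (X + Y) + (firstPass₀ a (sucℤ -[1+ e ]) + firstPass₀ a -[1+ suc e ]) * loopsᵛ b
    ≡⟨ cong (_+ (firstPass₀ a (sucℤ -[1+ e ]) + firstPass₀ a -[1+ suc e ]) * loopsᵛ b) (sym (Tᵛ-suc-<0 m e a (suc (suc b)))) ⟩
  xTimes (Tᵛ (suc m) -[1+ e ]) (suc a) (suc (suc b)) + firstPass₀ (suc a) -[1+ e ] * loopsᵛ b ∎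
  where
  open ≡-Reasoning
  len′ : a + suc b ≡ m
  len′ = suc-injective len
  X Y : ℕ
  X = xTimes (Tᵛ m (sucℤ -[1+ e ])) a (suc (suc b))
  Y = xTimes (Tᵛ m -[1+ suc e ]) a (suc (suc b))
  at-0 : ∀ a → a + suc b ≡ m → Tᵛ m (+ 0) a (suc b) ≡ xTimes (Tᵛ m (+ 0)) a (suc (suc b)) + firstPass₀ a (+ 0) * loopsᵛ b
  at-0 zero len = trans (Tᵛ-0-antidiagonal m symm b 0 len) (trans (cong (λ k → Tᵛ k (+ 0) b 1) (sym len)) (sym (*-identityˡ (loopsᵛ b))))
  at-0 (suc a) len = trans (sym (symm a b (trans (+-suc a (suc b)) len))) (sym (+-identityʳ _))
  from-h₊ : ∀ e → Tᵛ m (sucℤ -[1+ e ]) a (suc b) ≡ xTimes (Tᵛ m (sucℤ -[1+ e ])) a (suc (suc b)) + firstPass₀ a (sucℤ -[1+ e ]) * loopsᵛ b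
  from-h₊ zero = at-0 a len′
  from-h₊ (suc e) = below e a b len′

tradesᵛ : ∀ m → Symmetricᵛ m × TradeAboveᵛ m × TradeBelowᵛ m
tradesᵛ zero = (λ a b len → ⊥-elim (m+1+n≢0 a len)) , above , (λ e a b len → ⊥-elim (m+1+n≢0 a len))
  where
  above : TradeAboveᵛ 0
  above zero zero zero len = refl
  above (suc e) zero zero len = refl
tradesᵛ (suc m) with tradesᵛ m
... | symm , above , below = symmetricᵛ-suc m above below , tradeAboveᵛ-suc m symm above , tradeBelowᵛ-suc m symm below

Tᵛ-uniform : ∀ n a b → Tᵛ (suc (2 * n)) (+ 0) a (suc b) ≡ loops n * δ (2 * n) (a + b)
Tᵛ-uniform n a b with 2 * n ℕ.≟ a + b
... | yes 2n≡a+b = begin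
  Tᵛ (suc (2 * n)) (+ 0) a (suc b)   ≡⟨ Tᵛ-0-antidiagonal (suc (2 * n)) (proj₁ (tradesᵛ (suc (2 * n)))) b a len ⟩
  Tᵛ (suc (2 * n)) (+ 0) (a + b) 1   ≡⟨ cong (λ k → Tᵛ (suc (2 * n)) (+ 0) k 1) (sym 2n≡a+b) ⟩
  loopsᵛ (2 * n)                     ≡⟨ loopsᵛ≡loops n ⟩
  loops n                            ≡⟨ sym (*-identityʳ (loops n)) ⟩
  loops n * 1                        ∎
  where
  open ≡-Reasoning
  len : a + suc b ≡ suc (2 * n)
  len = trans (+-suc a b) (cong suc (sym 2n≡a+b))
... | no 2n≢a+b = trans (≢0-stable (λ T≢0 → 2n≢a+b
    (sym (suc-injective (trans (sym (+-suc a b)) (Tᵛ-support (suc (2 * n)) (+ 0) a (suc b) T≢0))))))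
                        (sym (*-zeroʳ (loops n)))

yh-term : ∀ n a b → count (λ p → endsAtOne p ∧ noClass p ∧ monoEq (vertexWeight (+ 0) p) (a , b)) (allPaths (suc (2 * n)))
                  ≡ Tᵛ (suc (2 * n)) (+ 0) a b
yh-term n = series-allPaths vertexWeight-obeys (suc (2 * n)) (+ 0)

yh-coefficient : ∀ a b → yh a b ≡ yTimes (homSum 2 Catalan) a b
yh-coefficient a zero = sumTo-zero (a + 0) (λ n _ → trans (yh-term n a 0) (Tᵛ-no-y (2 * n) (+ 0) a))
yh-coefficient a (suc b) = begin
  yh a (suc b)
    ≡⟨ sumTo-cong (a + suc b) (λ n _ → trans (yh-term n a (suc b)) (Tᵛ-uniform n a b)) ⟩
  sumTo (a + suc b) (λ n → loops n * δ (2 * n) (a + b))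
    ≡⟨ cong (λ N → sumTo N (λ n → loops n * δ (2 * n) (a + b))) (+-suc a b) ⟩
  sumTo (a + b) (λ n → loops n * δ (2 * n) (a + b)) + loops (suc (a + b)) * δ (2 * suc (a + b)) (a + b)
    ≡⟨ cong (_+_ _) (*δ-≢ (loops (suc (a + b))) (2[1+n]≢n (a + b))) ⟩
  sumTo (a + b) (λ n → loops n * δ (2 * n) (a + b)) + 0
    ≡⟨ +-identityʳ _ ⟩
  sumTo (a + b) (λ n → loops n * δ (2 * n) (a + b))
    ≡⟨ sumTo-cong (a + b) (λ n _ → cong (_* δ (2 * n) (a + b)) (sym (Catalan≡loops n))) ⟩
  sumTo (a + b) (λ n → Catalan n * δ (2 * n) (a + b))
    ≡⟨ sym (homSum-diagonal 2 Catalan a b) ⟩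
  homSum 2 Catalan a b ∎
  where
  open ≡-Reasoning
  2[1+n]≢n : ∀ n → 2 * suc n ≢ n
  2[1+n]≢n n eq = m≢1+m+n n (sym eq)

theorem10 : (∀ a b → xf a b ≡ xTimes (homSum 1 Catalan) a b)
    × (∀ a b → xg a b ≡ xTimes (homSum 1 (λ n → Catalan (suc n))) a b)
    × (∀ a b → yh a b ≡ yTimes (homSum 2 Catalan) a b)
theorem10 = xf-coefficient , xg-coefficient , yh-coefficient
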